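{- Let $\xi_0(q)$ be the unique formal power series in $q$ with $\Theta_0(-\xi_0(q),q)=0$, where $\Theta_0(x,q)=\sum_{n\ge0}x^nq^{\binom n2}$. Let $$\tilde F(a,q)=1+\sum_{D}a^{m(D)}q^{A(D)}=1+\sum_{n=1}^\infty\frac{a^nq^{n^2}}{(q;q)_n(aq;q)_{n-1}},$$ the sum over all Ferrers diagrams $D$ with rows $m_1\ge\dots\ge m_h\ge1$ such that $m_n=n$ for some positive integer $n$, where $m(D)=m_1$ is the width and $A(D)=\sum_i m_i$ the area (the term $1$ accounting for an "empty polyomino" of width $0$ and area $0$). Then $\xi_0(q)=\tilde F(\xi_0(q),q)$.
   Context: $\Theta_0(x,q)=\sum_{n=0}^\infty x^nq^{\binom n2}$; there is a unique formal power series $\xi_0(q)\in\mathbb{Z}[[q]]$ with $\Theta_0(-\xi_0(q),q)=0$. A Ferrers diagram is a finite weakly decreasing sequence of positive integers $m_1\ge\dots\ge m_h$ ($h\ge1$); width $m_1$, height $h$, area $\sum_i m_i$. Notation: $(t;q)_n=\prod_{i=0}^{n-1}(1-tq^i)$. -}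

module Defs where

open import Data.Nat as ℕ using (ℕ; zero; suc; _∸_; _≤ᵇ_; _≡ᵇ_)
open import Data.Nat.Combinatorics using (_C_)
open import Data.Integer as ℤ using (ℤ; 0ℤ; 1ℤ; -_)
open import Data.Bool using (Bool; true; false; _∧_; if_then_else_)
open import Data.List using (List; []; _∷_; map; concatMap; upTo; foldr)

-- Formal power series in q over ℤ, as coefficient functions: f n = [q^n] f.
FPS : Set
FPS = ℕ → ℤ

sumℤ : List ℤ → ℤ
sumℤ = foldr ℤ._+_ 0ℤ

Σ≤ : ℕ → (ℕ → ℤ) → ℤ
Σ≤ n g = sumℤ (map g (upTo (suc n)))

_·_ : FPS → FPS → FPS
(f · g) n = Σ≤ n (λ k → f k ℤ.* g (n ∸ k))

one : FPS
one zero    = 1ℤ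
one (suc _) = 0ℤ

pow : FPS → ℕ → FPS
pow f zero    = one
pow f (suc n) = f · pow f n

neg : FPS → FPS
neg f n = - f n

shift : ℕ → FPS → FPS
shift k f n = if k ≤ᵇ n then f (n ∸ k) else 0ℤ

-- The coefficient of q^N only receives contributions from n with C(n,2) ≤ N,
-- all of which satisfy n ≤ N+1 (since C(n,2) ≥ n-1); so the infinite sum is
-- computed coefficientwise by truncating at n = N+1.
Θ₀at : FPS → FPS
Θ₀at y N = Σ≤ (suc N) (λ n → shift (n C 2) (pow y n) N)

weaklyDecreasing : List ℕ → Bool
weaklyDecreasing []           = true
weaklyDecreasing (_ ∷ [])     = true
weaklyDecreasing (a ∷ b ∷ xs) = (b ≤ᵇ a) ∧ weaklyDecreasing (b ∷ xs)

allPositive : List ℕ → Bool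
allPositive []       = true
allPositive (x ∷ xs) = (1 ≤ᵇ x) ∧ allPositive xs

nonEmpty : List ℕ → Bool
nonEmpty []      = false
nonEmpty (_ ∷ _) = true

isFerrers : List ℕ → Bool
isFerrers D = nonEmpty D ∧ allPositive D ∧ weaklyDecreasing D

hasFixedFrom : ℕ → List ℕ → Bool
hasFixedFrom i []       = false
hasFixedFrom i (x ∷ xs) = if x ≡ᵇ i then true else hasFixedFrom (suc i) xs

hasFixedRow : List ℕ → Bool
hasFixedRow = hasFixedFrom 1

width : List ℕ → ℕ
width []      = 0
width (x ∷ _) = x

area : List ℕ → ℕ
area = foldr ℕ._+_ 0

listsOfLength : ℕ → ℕ → List (List ℕ)
listsOfLength B zero    = [] ∷ []
listsOfLength B (suc l) =
  concatMap (λ x → map (x ∷_) (listsOfLength B l)) (upTo (suc B))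

allLists : ℕ → ℕ → List (List ℕ)
allLists B L = concatMap (listsOfLength B) (upTo (suc L))

-- Every such D with A(D) ≤ N has height
-- ≤ N and width ≤ N, hence occurs exactly once in allLists N N.
F̃at : FPS → FPS
F̃at y N = one N ℤ.+ sumℤ (map term (allLists N N))
  where
  term : List ℕ → ℤ
  term D = if isFerrers D ∧ hasFixedRow D ∧ (area D ≤ᵇ N)
           then shift (area D) (pow y (width D)) N
           else 0ℤ

module Submission where

-- Splitting a diagram after its first row m gives F̃(a,q) = 1 + Σ_{m≥1} a^m G_m(q), where G_m
-- counts partitions with largest part m having a row m_n = n.  Recursing on the first row,
-- the partitions with largest part i + d whose rows (indexed from i) never meet their index are
-- q^d times those with rows ≤ i + d - 1 that do.  This yields G_1 = c_0 + c_1 and G_m = c_m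
-- for m ≥ 2, where Σ_m c_m a^m = Θ₀(-a,q) · Σ_w a^w q^w/(q;q)_w and c_0 = 1.  Hence
-- F̃(a,q) = a + Θ₀(-a,q) · Σ_w a^w q^w/(q;q)_w, whose second term vanishes at a = ξ₀.

open import Defs
open import Data.Nat using (ℕ; zero; suc; _∸_; z≤n; s≤s; _≤ᵇ_; _≡ᵇ_)
  renaming (_+_ to _+ℕ_; _≤_ to _≤ℕ_; _<_ to _<ℕ_)
import Data.Nat.Properties as ℕₚ
import Data.Nat.Tactic.RingSolver as ℕ-Solver
open import Data.Nat.Combinatorics using (_C_; nCk+nC[k+1]≡[n+1]C[k+1]; nC1≡n)
open import Data.Integer using (ℤ; 0ℤ; 1ℤ; -_; _+_; _*_; _-_)
import Data.Integer.Properties as ℤₚ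
open import Data.Integer.Tactic.RingSolver using (solve-∀)
open import Data.Bool using (Bool; true; false; T; if_then_else_; _∧_)
import Data.Bool.Properties as Boolₚ
open import Data.List using (List; []; _∷_; map; concatMap; upTo; applyUpTo; _++_)
open import Data.Sum using (inj₁; inj₂)
open import Data.Empty using (⊥; ⊥-elim)
open import Function using (_∘_; id)
open import Data.Nat.Induction using (<-rec)
open import Relation.Binary.Bundles using (Setoid)
open import Relation.Binary.PropositionalEquality
import Relation.Binary.Reasoning.Setoid as SetoidReasoning

-- Finite sums

Σ< : ℕ → (ℕ → ℤ) → ℤ
Σ< zero    f = 0ℤ
Σ< (suc n) f = Σ< n f + f n

module _ where
  open ≡-Reasoning

  Σ<-cong : ∀ n {f g : ℕ → ℤ} → (∀ k → k <ℕ n → f k ≡ g k) → Σ< n f ≡ Σ< n g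
  Σ<-cong zero    eq = refl
  Σ<-cong (suc n) eq = cong₂ _+_ (Σ<-cong n (λ k k<n → eq k (ℕₚ.m<n⇒m<1+n k<n))) (eq n ℕₚ.≤-refl)

  Σ<-zero : ∀ n {f : ℕ → ℤ} → (∀ k → k <ℕ n → f k ≡ 0ℤ) → Σ< n f ≡ 0ℤ
  Σ<-zero zero    eq = refl
  Σ<-zero (suc n) eq =
    cong₂ _+_ (Σ<-zero n (λ k k<n → eq k (ℕₚ.m<n⇒m<1+n k<n))) (eq n ℕₚ.≤-refl)

  Σ<-+ : ∀ n (f g : ℕ → ℤ) → Σ< n (λ k → f k + g k) ≡ Σ< n f + Σ< n g
  Σ<-+ zero    f g = refl
  Σ<-+ (suc n) f g = trans (cong (_+ (f n + g n)) (Σ<-+ n f g)) (interchange (Σ< n f) (Σ< n g) (f n) (g n))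
    where
    interchange : ∀ a b c d → a + b + (c + d) ≡ a + c + (b + d)
    interchange = solve-∀

  Σ<-*ˡ : ∀ n c (f : ℕ → ℤ) → Σ< n (λ k → c * f k) ≡ c * Σ< n f
  Σ<-*ˡ zero    c f = sym (ℤₚ.*-zeroʳ c)
  Σ<-*ˡ (suc n) c f =
    trans (cong (_+ c * f n) (Σ<-*ˡ n c f)) (sym (ℤₚ.*-distribˡ-+ c (Σ< n f) (f n)))

  Σ<-*ʳ : ∀ n c (f : ℕ → ℤ) → Σ< n (λ k → f k * c) ≡ Σ< n f * c
  Σ<-*ʳ n c f = begin
    Σ< n (λ k → f k * c) ≡⟨ Σ<-cong n (λ k _ → ℤₚ.*-comm (f k) c) ⟩
    Σ< n (λ k → c * f k) ≡⟨ Σ<-*ˡ n c f ⟩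
    c * Σ< n f           ≡⟨ ℤₚ.*-comm c (Σ< n f) ⟩
    Σ< n f * c           ∎

  Σ<-neg : ∀ n (f : ℕ → ℤ) → Σ< n (λ k → - f k) ≡ - Σ< n f
  Σ<-neg zero    f = refl
  Σ<-neg (suc n) f =
    trans (cong (_+ - f n) (Σ<-neg n f)) (sym (ℤₚ.neg-distrib-+ (Σ< n f) (f n)))

  Σ<-head : ∀ n (f : ℕ → ℤ) → Σ< (suc n) f ≡ f 0 + Σ< n (f ∘ suc)
  Σ<-head zero    f = trans (ℤₚ.+-identityˡ (f 0)) (sym (ℤₚ.+-identityʳ (f 0)))
  Σ<-head (suc n) f = begin
    Σ< (suc n) f + f (suc n)           ≡⟨ cong (_+ f (suc n)) (Σ<-head n f) ⟩
    f 0 + Σ< n (f ∘ suc) + f (suc n)   ≡⟨ ℤₚ.+-assoc (f 0) _ _ ⟩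
    f 0 + Σ< (suc n) (f ∘ suc)         ∎

  Σ<-split : ∀ a b (f : ℕ → ℤ) → Σ< (a +ℕ b) f ≡ Σ< a f + Σ< b (λ j → f (a +ℕ j))
  Σ<-split a zero    f = trans (cong (λ n → Σ< n f) (ℕₚ.+-identityʳ a)) (sym (ℤₚ.+-identityʳ _))
  Σ<-split a (suc b) f = begin
    Σ< (a +ℕ suc b) f                              ≡⟨ cong (λ n → Σ< n f) (ℕₚ.+-suc a b) ⟩
    Σ< (a +ℕ b) f + f (a +ℕ b)                     ≡⟨ cong (_+ f (a +ℕ b)) (Σ<-split a b f) ⟩
    Σ< a f + Σ< b (λ j → f (a +ℕ j)) + f (a +ℕ b)  ≡⟨ ℤₚ.+-assoc (Σ< a f) _ _ ⟩
    Σ< a f + Σ< (suc b) (λ j → f (a +ℕ j))         ∎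

  Σ<-swap : ∀ n m (F : ℕ → ℕ → ℤ) → Σ< n (λ i → Σ< m (F i)) ≡ Σ< m (λ j → Σ< n (λ i → F i j))
  Σ<-swap zero    m F = sym (Σ<-zero m (λ _ _ → refl))
  Σ<-swap (suc n) m F =
    trans (cong (_+ Σ< m (F n)) (Σ<-swap n m F)) (sym (Σ<-+ m _ (F n)))

  Σ<-triangle : ∀ n (F : ℕ → ℕ → ℤ) →
    Σ< n (λ k → Σ< (suc k) (λ j → F j (k ∸ j))) ≡ Σ< n (λ j → Σ< (n ∸ j) (F j))
  Σ<-triangle zero    F = refl
  Σ<-triangle (suc n) F = begin
    Σ< n (λ k → Σ< (suc k) (λ j → F j (k ∸ j))) + Σ< (suc n) (λ j → F j (n ∸ j))
      ≡⟨ cong (_+ Σ< (suc n) (λ j → F j (n ∸ j))) (Σ<-triangle n F) ⟩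
    Σ< n (λ j → Σ< (n ∸ j) (F j)) + (Σ< n (λ j → F j (n ∸ j)) + F n (n ∸ n))
      ≡⟨ sym (ℤₚ.+-assoc (Σ< n (λ j → Σ< (n ∸ j) (F j))) _ _) ⟩
    Σ< n (λ j → Σ< (n ∸ j) (F j)) + Σ< n (λ j → F j (n ∸ j)) + F n (n ∸ n)
      ≡⟨ cong₂ _+_ (sym (Σ<-+ n _ _)) (cong (F n) (ℕₚ.n∸n≡0 n)) ⟩
    Σ< n (λ j → Σ< (suc (n ∸ j)) (F j)) + F n 0
      ≡⟨ cong₂ _+_ (Σ<-cong n (λ j j<n → cong (λ l → Σ< l (F j)) (sym (ℕₚ.+-∸-assoc 1 (ℕₚ.<⇒≤ j<n)))))
                   (sym (ℤₚ.+-identityˡ _)) ⟩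
    Σ< n (λ j → Σ< (suc n ∸ j) (F j)) + Σ< 1 (F n)
      ≡⟨ cong (λ l → Σ< n (λ j → Σ< (suc n ∸ j) (F j)) + Σ< l (F n)) (sym (ℕₚ.m+n∸n≡m 1 n)) ⟩
    Σ< n (λ j → Σ< (suc n ∸ j) (F j)) + Σ< (suc n ∸ n) (F n)
      ∎

  Σ<-reverse : ∀ n (f : ℕ → ℤ) → Σ< n f ≡ Σ< n (λ k → f (n ∸ suc k))
  Σ<-reverse zero    f = refl
  Σ<-reverse (suc n) f = begin
    Σ< n f + f n                          ≡⟨ cong (_+ f n) (Σ<-reverse n f) ⟩
    Σ< n (λ k → f (n ∸ suc k)) + f n      ≡⟨ ℤₚ.+-comm _ (f n) ⟩
    f n + Σ< n (λ k → f (n ∸ suc k))      ≡⟨ sym (Σ<-head n (λ k → f (suc n ∸ suc k))) ⟩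
    Σ< (suc n) (λ k → f (suc n ∸ suc k))  ∎

sumOver : {A : Set} → List A → (A → ℤ) → ℤ
sumOver xs f = sumℤ (map f xs)

module _ {A : Set} where
  open ≡-Reasoning

  sumOver-cong : ∀ (xs : List A) {f g : A → ℤ} → (∀ x → f x ≡ g x) → sumOver xs f ≡ sumOver xs g
  sumOver-cong []       eq = refl
  sumOver-cong (x ∷ xs) eq = cong₂ _+_ (eq x) (sumOver-cong xs eq)

  sumOver-zero : ∀ (xs : List A) → sumOver xs (λ _ → 0ℤ) ≡ 0ℤ
  sumOver-zero []       = refl
  sumOver-zero (x ∷ xs) = trans (ℤₚ.+-identityˡ _) (sumOver-zero xs)

  sumOver-*ˡ : ∀ (xs : List A) c f → sumOver xs (λ x → c * f x) ≡ c * sumOver xs f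
  sumOver-*ˡ []       c f = sym (ℤₚ.*-zeroʳ c)
  sumOver-*ˡ (x ∷ xs) c f =
    trans (cong (c * f x +_) (sumOver-*ˡ xs c f)) (sym (ℤₚ.*-distribˡ-+ c (f x) _))

  sumOver-*ʳ : ∀ (xs : List A) c f → sumOver xs (λ x → f x * c) ≡ sumOver xs f * c
  sumOver-*ʳ xs c f = begin
    sumOver xs (λ x → f x * c)  ≡⟨ sumOver-cong xs (λ x → ℤₚ.*-comm (f x) c) ⟩
    sumOver xs (λ x → c * f x)  ≡⟨ sumOver-*ˡ xs c f ⟩
    c * sumOver xs f            ≡⟨ ℤₚ.*-comm c (sumOver xs f) ⟩
    sumOver xs f * c            ∎

  sumOver-++ : ∀ (xs ys : List A) f → sumOver (xs ++ ys) f ≡ sumOver xs f + sumOver ys f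
  sumOver-++ []       ys f = sym (ℤₚ.+-identityˡ _)
  sumOver-++ (x ∷ xs) ys f =
    trans (cong (f x +_) (sumOver-++ xs ys f)) (sym (ℤₚ.+-assoc (f x) _ _))

  sumOver-Σ< : ∀ (xs : List A) n (F : A → ℕ → ℤ) →
    sumOver xs (λ x → Σ< n (F x)) ≡ Σ< n (λ k → sumOver xs (λ x → F x k))
  sumOver-Σ< []       n F = sym (Σ<-zero n (λ _ _ → refl))
  sumOver-Σ< (x ∷ xs) n F = trans (cong (Σ< n (F x) +_) (sumOver-Σ< xs n F)) (sym (Σ<-+ n _ _))

sumOver-map : ∀ {A B : Set} (h : A → B) (xs : List A) f → sumOver (map h xs) f ≡ sumOver xs (f ∘ h)
sumOver-map h []       f = refl
sumOver-map h (x ∷ xs) f = cong (f (h x) +_) (sumOver-map h xs f)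

sumOver-concatMap : ∀ {A B : Set} (g : A → List B) (xs : List A) f →
  sumOver (concatMap g xs) f ≡ sumOver xs (λ x → sumOver (g x) f)
sumOver-concatMap g []       f = refl
sumOver-concatMap g (x ∷ xs) f =
  trans (sumOver-++ (g x) (concatMap g xs) f) (cong (sumOver (g x) f +_) (sumOver-concatMap g xs f))

sumOver-applyUpTo : ∀ n (g : ℕ → ℕ) (f : ℕ → ℤ) → sumOver (applyUpTo g n) f ≡ Σ< n (f ∘ g)
sumOver-applyUpTo zero    g f = refl
sumOver-applyUpTo (suc n) g f =
  trans (cong (f (g 0) +_) (sumOver-applyUpTo n (g ∘ suc) f)) (sym (Σ<-head n (f ∘ g)))

Σ≤-Σ< : ∀ n f → Σ≤ n f ≡ Σ< (suc n) f
Σ≤-Σ< n f = sumOver-applyUpTo (suc n) id f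

-- Formal power series

-- A record rather than ∀ n → f n ≡ g n, so that both series can be inferred from a proof.
infix 4 _≈_
record _≈_ (f g : FPS) : Set where
  constructor coeffwise
  field at : ∀ n → f n ≡ g n
open _≈_ public

≈-refl : ∀ {f} → f ≈ f
≈-refl = coeffwise (λ _ → refl)

≈-sym : ∀ {f g} → f ≈ g → g ≈ f
≈-sym p = coeffwise (λ n → sym (at p n))

≈-trans : ∀ {f g h} → f ≈ g → g ≈ h → f ≈ h
≈-trans p q = coeffwise (λ n → trans (at p n) (at q n))

≈-setoid : Setoid _ _
≈-setoid = record
  { Carrier       = FPS
  ; _≈_           = _≈_
  ; isEquivalence = record { refl = ≈-refl ; sym = ≈-sym ; trans = ≈-trans }
  }

module ≈-Reasoning = SetoidReasoning ≈-setoid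

zeroₛ : FPS
zeroₛ _ = 0ℤ

infixl 6 _⊕_ _⊖_
_⊕_ : FPS → FPS → FPS
(f ⊕ g) n = f n + g n

_⊖_ : FPS → FPS → FPS
(f ⊖ g) n = f n - g n

infixr 7 _*ₗ_
_*ₗ_ : ℤ → FPS → FPS
(c *ₗ f) n = c * f n

Σₛ : ℕ → (ℕ → FPS) → FPS
Σₛ m F n = Σ< m (λ i → F i n)

⊕-cong : ∀ {f f′ g g′} → f ≈ f′ → g ≈ g′ → f ⊕ g ≈ f′ ⊕ g′
⊕-cong p q = coeffwise (λ n → cong₂ _+_ (at p n) (at q n))

⊖-cong : ∀ {f f′ g g′} → f ≈ f′ → g ≈ g′ → f ⊖ g ≈ f′ ⊖ g′
⊖-cong p q = coeffwise (λ n → cong₂ _-_ (at p n) (at q n))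

⊕-congˡ : ∀ {f f′} g → f ≈ f′ → f ⊕ g ≈ f′ ⊕ g
⊕-congˡ g p = ⊕-cong p (≈-refl {g})

⊕-congʳ : ∀ f {g g′} → g ≈ g′ → f ⊕ g ≈ f ⊕ g′
⊕-congʳ f p = ⊕-cong (≈-refl {f}) p

⊖-congʳ : ∀ f {g g′} → g ≈ g′ → f ⊖ g ≈ f ⊖ g′
⊖-congʳ f p = ⊖-cong (≈-refl {f}) p

*ₗ-cong : ∀ c {f g} → f ≈ g → c *ₗ f ≈ c *ₗ g
*ₗ-cong c p = coeffwise (λ n → cong (c *_) (at p n))

⊕-identityˡ : ∀ {f} g → f ≈ zeroₛ → f ⊕ g ≈ g
⊕-identityˡ g p = coeffwise (λ n → trans (cong (_+ g n) (at p n)) (ℤₚ.+-identityˡ (g n)))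

⊕-assoc : ∀ f g h → f ⊕ g ⊕ h ≈ f ⊕ (g ⊕ h)
⊕-assoc f g h = coeffwise (λ n → ℤₚ.+-assoc (f n) (g n) (h n))

⊕-⊖-assoc : ∀ f g h → f ⊕ g ⊖ h ≈ f ⊕ (g ⊖ h)
⊕-⊖-assoc f g h = coeffwise (λ n → ℤₚ.+-assoc (f n) (g n) (- h n))

⊖-zeroʳ : ∀ f {g} → g ≈ zeroₛ → f ⊖ g ≈ f
⊖-zeroʳ f p = coeffwise (λ n → trans (cong (λ x → f n - x) (at p n)) (ℤₚ.+-identityʳ (f n)))

⊖-self : ∀ f → f ⊖ f ≈ zeroₛ
⊖-self f = coeffwise (λ n → ℤₚ.+-inverseʳ (f n))

Σₛ-cong : ∀ m {F G : ℕ → FPS} → (∀ i → i <ℕ m → F i ≈ G i) → Σₛ m F ≈ Σₛ m G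
Σₛ-cong m eq = coeffwise (λ n → Σ<-cong m (λ i i<m → at (eq i i<m) n))

Σₛ-zero : ∀ m {F : ℕ → FPS} → (∀ i → i <ℕ m → F i ≈ zeroₛ) → Σₛ m F ≈ zeroₛ
Σₛ-zero m eq = coeffwise (λ n → Σ<-zero m (λ i i<m → at (eq i i<m) n))

Σₛ-split : ∀ a b F → Σₛ (a +ℕ b) F ≈ Σₛ a F ⊕ Σₛ b (λ j → F (a +ℕ j))
Σₛ-split a b F = coeffwise (λ n → Σ<-split a b (λ i → F i n))

Σₛ-head : ∀ m F → Σₛ (suc m) F ≈ F 0 ⊕ Σₛ m (F ∘ suc)
Σₛ-head m F = coeffwise (λ n → Σ<-head m (λ i → F i n))

Σₛ-⊖ : ∀ m F G → Σₛ m (λ i → F i ⊖ G i) ≈ Σₛ m F ⊖ Σₛ m G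
Σₛ-⊖ m F G = coeffwise λ n →
  trans (Σ<-+ m (λ i → F i n) (λ i → - G i n)) (cong (Σ< m (λ i → F i n) +_) (Σ<-neg m (λ i → G i n)))

*ₗ-Σₛ : ∀ c m F → c *ₗ Σₛ m F ≈ Σₛ m (λ i → c *ₗ F i)
*ₗ-Σₛ c m F = coeffwise (λ n → sym (Σ<-*ˡ m c (λ i → F i n)))

T⇒≡true : ∀ {b} → T b → b ≡ true
T⇒≡true {true} _ = refl

¬T⇒≡false : ∀ {b} → (T b → ⊥) → b ≡ false
¬T⇒≡false {true}  ¬t = ⊥-elim (¬t _)
¬T⇒≡false {false} _  = refl

≤⇒≤ᵇ≡true : ∀ {m n} → m ≤ℕ n → (m ≤ᵇ n) ≡ true
≤⇒≤ᵇ≡true = T⇒≡true ∘ ℕₚ.≤⇒≤ᵇ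

>⇒≤ᵇ≡false : ∀ {m n} → n <ℕ m → (m ≤ᵇ n) ≡ false
>⇒≤ᵇ≡false {m} {n} n<m = ¬T⇒≡false (ℕₚ.<⇒≱ n<m ∘ ℕₚ.≤ᵇ⇒≤ m n)

≡ᵇ-refl : ∀ n → (n ≡ᵇ n) ≡ true
≡ᵇ-refl n = T⇒≡true (ℕₚ.≡⇒≡ᵇ n n refl)

≢⇒≡ᵇ≡false : ∀ {m n} → m ≢ n → (m ≡ᵇ n) ≡ false
≢⇒≡ᵇ≡false {m} {n} m≢n = ¬T⇒≡false (m≢n ∘ ℕₚ.≡ᵇ⇒≡ m n)

shift-≥ : ∀ a f {n} → a ≤ℕ n → shift a f n ≡ f (n ∸ a)
shift-≥ a f a≤n rewrite ≤⇒≤ᵇ≡true a≤n = refl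

shift-< : ∀ a f {n} → n <ℕ a → shift a f n ≡ 0ℤ
shift-< a f n<a rewrite >⇒≤ᵇ≡false n<a = refl

shift-cong-at : ∀ a f g n → (a ≤ℕ n → f (n ∸ a) ≡ g (n ∸ a)) → shift a f n ≡ shift a g n
shift-cong-at a f g n eq with ℕₚ.≤-<-connex a n
... | inj₁ a≤n = trans (shift-≥ a f a≤n) (trans (eq a≤n) (sym (shift-≥ a g a≤n)))
... | inj₂ n<a = trans (shift-< a f n<a) (sym (shift-< a g n<a))

shift-cong : ∀ a {f g} → f ≈ g → shift a f ≈ shift a g
shift-cong a {f} {g} p = coeffwise (λ n → shift-cong-at a f g n (λ _ → at p (n ∸ a)))

module _ (a : ℕ) where

  shift-zero : shift a zeroₛ ≈ zeroₛ
  shift-zero = coeffwise at-n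
    where
    at-n : ∀ n → shift a zeroₛ n ≡ 0ℤ
    at-n n with a ≤ᵇ n
    ... | true  = refl
    ... | false = refl

  shift-⊕ : ∀ f g → shift a (f ⊕ g) ≈ shift a f ⊕ shift a g
  shift-⊕ f g = coeffwise at-n
    where
    at-n : ∀ n → shift a (f ⊕ g) n ≡ (shift a f ⊕ shift a g) n
    at-n n with a ≤ᵇ n
    ... | true  = refl
    ... | false = refl

  shift-⊖ : ∀ f g → shift a (f ⊖ g) ≈ shift a f ⊖ shift a g
  shift-⊖ f g = coeffwise at-n
    where
    at-n : ∀ n → shift a (f ⊖ g) n ≡ (shift a f ⊖ shift a g) n
    at-n n with a ≤ᵇ n
    ... | true  = refl
    ... | false = refl

  shift-*ₗ : ∀ c f → shift a (c *ₗ f) ≈ c *ₗ shift a f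
  shift-*ₗ c f = coeffwise at-n
    where
    at-n : ∀ n → shift a (c *ₗ f) n ≡ (c *ₗ shift a f) n
    at-n n with a ≤ᵇ n
    ... | true  = refl
    ... | false = sym (ℤₚ.*-zeroʳ c)

  shift-Σₛ : ∀ m F → shift a (Σₛ m F) ≈ Σₛ m (λ i → shift a (F i))
  shift-Σₛ m F = coeffwise at-n
    where
    at-n : ∀ n → shift a (Σₛ m F) n ≡ Σₛ m (λ i → shift a (F i)) n
    at-n n with a ≤ᵇ n
    ... | true  = refl
    ... | false = sym (Σ<-zero m (λ _ _ → refl))

shift-+ : ∀ a b f → shift a (shift b f) ≈ shift (a +ℕ b) f
shift-+ a b f = coeffwise at-n
  where
  at-n : ∀ n → shift a (shift b f) n ≡ shift (a +ℕ b) f n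
  at-n n with ℕₚ.≤-<-connex a n
  ... | inj₂ n<a =
    trans (shift-< a (shift b f) n<a) (sym (shift-< (a +ℕ b) f (ℕₚ.<-≤-trans n<a (ℕₚ.m≤m+n a b))))
  ... | inj₁ a≤n with ℕₚ.≤-<-connex b (n ∸ a)
  ...   | inj₁ b≤n∸a = begin
    shift a (shift b f) n ≡⟨ shift-≥ a (shift b f) a≤n ⟩
    shift b f (n ∸ a)     ≡⟨ shift-≥ b f b≤n∸a ⟩
    f (n ∸ a ∸ b)         ≡⟨ cong f (ℕₚ.∸-+-assoc n a b) ⟩
    f (n ∸ (a +ℕ b))      ≡⟨ sym (shift-≥ (a +ℕ b) f a+b≤n) ⟩
    shift (a +ℕ b) f n    ∎
    where
    open ≡-Reasoning
    a+b≤n : a +ℕ b ≤ℕ n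
    a+b≤n = ℕₚ.≤-trans (ℕₚ.≤-reflexive (ℕₚ.+-comm a b)) (ℕₚ.m≤o∸n⇒m+n≤o b a≤n b≤n∸a)
  ...   | inj₂ n∸a<b = begin
    shift a (shift b f) n ≡⟨ shift-≥ a (shift b f) a≤n ⟩
    shift b f (n ∸ a)     ≡⟨ shift-< b f n∸a<b ⟩
    0ℤ                    ≡⟨ sym (shift-< (a +ℕ b) f n<a+b) ⟩
    shift (a +ℕ b) f n    ∎
    where
    open ≡-Reasoning
    n<a+b : n <ℕ a +ℕ b
    n<a+b = ℕₚ.≤-<-trans (ℕₚ.≤-reflexive (sym (ℕₚ.m+[n∸m]≡n a≤n))) (ℕₚ.+-monoʳ-< a n∸a<b)

·-coeff : ∀ f g n → (f · g) n ≡ Σ< (suc n) (λ k → f k * g (n ∸ k))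
·-coeff f g n = Σ≤-Σ< n _

module _ where
  open ≡-Reasoning

  ·-cong : ∀ {f f′ g g′} → f ≈ f′ → g ≈ g′ → f · g ≈ f′ · g′
  ·-cong {f} {f′} {g} {g′} p q = coeffwise λ n → begin
    (f · g) n                               ≡⟨ ·-coeff f g n ⟩
    Σ< (suc n) (λ k → f k * g (n ∸ k))      ≡⟨ Σ<-cong (suc n) (λ k _ → cong₂ _*_ (at p k) (at q (n ∸ k))) ⟩
    Σ< (suc n) (λ k → f′ k * g′ (n ∸ k))    ≡⟨ ·-coeff f′ g′ n ⟨
    (f′ · g′) n                             ∎

  ·-comm : ∀ f g → f · g ≈ g · f
  ·-comm f g = coeffwise λ n → begin
    (f · g) n                                          ≡⟨ ·-coeff f g n ⟩
    Σ< (suc n) (λ k → f k * g (n ∸ k))                 ≡⟨ Σ<-reverse (suc n) _ ⟩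
    Σ< (suc n) (λ k → f (n ∸ k) * g (n ∸ (n ∸ k)))     ≡⟨ Σ<-cong (suc n) (λ k k≤n →
                    trans (cong (f (n ∸ k) *_) (cong g (ℕₚ.m∸[m∸n]≡n (ℕₚ.m<1+n⇒m≤n k≤n))))
                          (ℤₚ.*-comm (f (n ∸ k)) (g k))) ⟩
    Σ< (suc n) (λ k → g k * f (n ∸ k))                 ≡⟨ ·-coeff g f n ⟨
    (g · f) n                                          ∎

  ·-assoc : ∀ f g h → (f · g) · h ≈ f · (g · h)
  ·-assoc f g h = coeffwise assoc-at
    where
    assoc-at : ∀ n → ((f · g) · h) n ≡ (f · (g · h)) n
    assoc-at n = begin
        ((f · g) · h) n
          ≡⟨ ·-coeff (f · g) h n ⟩
        Σ< (suc n) (λ k → (f · g) k * h (n ∸ k))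
          ≡⟨ Σ<-cong (suc n) (λ k k≤n → trans (cong (_* h (n ∸ k)) (·-coeff f g k))
                                      (trans (sym (Σ<-*ʳ (suc k) (h (n ∸ k)) _))
                                             (Σ<-cong (suc k) (λ j j≤k → reindex (ℕₚ.m<1+n⇒m≤n j≤k))))) ⟩
        Σ< (suc n) (λ k → Σ< (suc k) (λ j → F j (k ∸ j)))
          ≡⟨ Σ<-triangle (suc n) F ⟩
        Σ< (suc n) (λ j → Σ< (suc n ∸ j) (F j))
          ≡⟨ Σ<-cong (suc n) (λ j j≤n → trans (cong (λ l → Σ< l (F j)) (ℕₚ.+-∸-assoc 1 (ℕₚ.m<1+n⇒m≤n j≤n)))
                                      (trans (Σ<-cong (suc (n ∸ j)) (λ i _ → reassoc j i))
                                             (Σ<-*ˡ (suc (n ∸ j)) (f j) _))) ⟩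
        Σ< (suc n) (λ j → f j * Σ< (suc (n ∸ j)) (λ i → g i * h (n ∸ j ∸ i)))
          ≡⟨ Σ<-cong (suc n) (λ j _ → cong (f j *_) (·-coeff g h (n ∸ j))) ⟨
        Σ< (suc n) (λ j → f j * (g · h) (n ∸ j))
          ≡⟨ ·-coeff f (g · h) n ⟨
        (f · (g · h)) n
          ∎
        where
        F : ℕ → ℕ → ℤ
        F j i = f j * g i * h (n ∸ (j +ℕ i))
        reindex : ∀ {j k} → j ≤ℕ k → f j * g (k ∸ j) * h (n ∸ k) ≡ F j (k ∸ j)
        reindex {j} {k} j≤k = cong (λ l → f j * g (k ∸ j) * h (n ∸ l)) (sym (ℕₚ.m+[n∸m]≡n j≤k))
        reassoc : ∀ j i → F j i ≡ f j * (g i * h (n ∸ j ∸ i))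
        reassoc j i = trans (ℤₚ.*-assoc (f j) (g i) _) (cong (λ l → f j * (g i * h l)) (sym (ℕₚ.∸-+-assoc n j i)))

  one-· : ∀ f → one · f ≈ f
  one-· f = coeffwise λ n → begin
    (one · f) n                                          ≡⟨ ·-coeff one f n ⟩
    Σ< (suc n) (λ k → one k * f (n ∸ k))                 ≡⟨ Σ<-head n _ ⟩
    1ℤ * f n + Σ< n (λ k → 0ℤ * f (n ∸ suc k))           ≡⟨ cong₂ _+_ (ℤₚ.*-identityˡ (f n)) (Σ<-zero n (λ _ _ → refl)) ⟩
    f n + 0ℤ                                             ≡⟨ ℤₚ.+-identityʳ (f n) ⟩
    f n                                                  ∎

  ·-one : ∀ f → f · one ≈ f
  ·-one f = ≈-trans (·-comm f one) (one-· f)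

  ·-Σₛ : ∀ f m G → f · Σₛ m G ≈ Σₛ m (λ i → f · G i)
  ·-Σₛ f m G = coeffwise λ n → begin
    (f · Σₛ m G) n                                       ≡⟨ ·-coeff f (Σₛ m G) n ⟩
    Σ< (suc n) (λ k → f k * Σ< m (λ i → G i (n ∸ k)))    ≡⟨ Σ<-cong (suc n) (λ k _ → Σ<-*ˡ m (f k) _) ⟨
    Σ< (suc n) (λ k → Σ< m (λ i → f k * G i (n ∸ k)))    ≡⟨ Σ<-swap (suc n) m _ ⟩
    Σ< m (λ i → Σ< (suc n) (λ k → f k * G i (n ∸ k)))    ≡⟨ Σ<-cong m (λ i _ → ·-coeff f (G i) n) ⟨
    Σₛ m (λ i → f · G i) n                               ∎

  ·-*ₗ : ∀ c f g → f · (c *ₗ g) ≈ c *ₗ (f · g)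
  ·-*ₗ c f g = coeffwise λ n → begin
    (f · (c *ₗ g)) n                          ≡⟨ ·-coeff f (c *ₗ g) n ⟩
    Σ< (suc n) (λ k → f k * (c * g (n ∸ k)))  ≡⟨ Σ<-cong (suc n) (λ k _ → swap-front (f k) c (g (n ∸ k))) ⟩
    Σ< (suc n) (λ k → c * (f k * g (n ∸ k)))  ≡⟨ Σ<-*ˡ (suc n) c _ ⟩
    c * Σ< (suc n) (λ k → f k * g (n ∸ k))    ≡⟨ cong (c *_) (·-coeff f g n) ⟨
    (c *ₗ (f · g)) n                          ∎
    where
    swap-front : ∀ a b d → a * (b * d) ≡ b * (a * d)
    swap-front = solve-∀

*ₗ-· : ∀ c f g → (c *ₗ f) · g ≈ c *ₗ (f · g)
*ₗ-· c f g = ≈-trans (·-comm (c *ₗ f) g) (≈-trans (·-*ₗ c g f) (*ₗ-cong c (·-comm g f)))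

Σₛ-· : ∀ m F g → Σₛ m F · g ≈ Σₛ m (λ i → F i · g)
Σₛ-· m F g = ≈-trans (·-comm (Σₛ m F) g) (≈-trans (·-Σₛ g m F) (Σₛ-cong m (λ i _ → ·-comm g (F i))))

shift-·ˡ : ∀ a f g → shift a f · g ≈ shift a (f · g)
shift-·ˡ a f g = coeffwise shift-at
  where
  open ≡-Reasoning
  term : ℕ → ℕ → ℤ
  term n k = shift a f k * g (n ∸ k)
  term-< : ∀ n k → k <ℕ a → term n k ≡ 0ℤ
  term-< n k k<a = cong (_* g (n ∸ k)) (shift-< a f k<a)
  shift-at : ∀ n → (shift a f · g) n ≡ shift a (f · g) n
  shift-at n with ℕₚ.≤-<-connex a n
  ... | inj₁ a≤n = begin
    (shift a f · g) n                                        ≡⟨ ·-coeff (shift a f) g n ⟩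
    Σ< (suc n) (term n)                                      ≡⟨ cong (λ l → Σ< l (term n)) n+1≡a+[n-a+1] ⟩
    Σ< (a +ℕ suc (n ∸ a)) (term n)                           ≡⟨ Σ<-split a (suc (n ∸ a)) (term n) ⟩
    Σ< a (term n) + Σ< (suc (n ∸ a)) (λ j → term n (a +ℕ j)) ≡⟨ cong₂ _+_ (Σ<-zero a (term-< n)) (Σ<-cong (suc (n ∸ a)) (λ j _ → shifted j)) ⟩
    0ℤ + Σ< (suc (n ∸ a)) (λ j → f j * g (n ∸ a ∸ j))       ≡⟨ ℤₚ.+-identityˡ _ ⟩
    Σ< (suc (n ∸ a)) (λ j → f j * g (n ∸ a ∸ j))            ≡⟨ ·-coeff f g (n ∸ a) ⟨
    (f · g) (n ∸ a)                                          ≡⟨ shift-≥ a (f · g) a≤n ⟨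
    shift a (f · g) n                                        ∎
    where
    n+1≡a+[n-a+1] : suc n ≡ a +ℕ suc (n ∸ a)
    n+1≡a+[n-a+1] = sym (trans (ℕₚ.+-suc a (n ∸ a)) (cong suc (ℕₚ.m+[n∸m]≡n a≤n)))
    shifted : ∀ j → term n (a +ℕ j) ≡ f j * g (n ∸ a ∸ j)
    shifted j = cong₂ _*_ (trans (shift-≥ a f (ℕₚ.m≤m+n a j)) (cong f (ℕₚ.m+n∸m≡n a j)))
                          (cong g (sym (ℕₚ.∸-+-assoc n a j)))
  ... | inj₂ n<a = begin
    (shift a f · g) n     ≡⟨ ·-coeff (shift a f) g n ⟩
    Σ< (suc n) (term n)   ≡⟨ Σ<-zero (suc n) (λ k k≤n → term-< n k (ℕₚ.≤-<-trans (ℕₚ.m<1+n⇒m≤n k≤n) n<a)) ⟩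
    0ℤ                    ≡⟨ shift-< a (f · g) n<a ⟨
    shift a (f · g) n     ∎

shift-·ʳ : ∀ a f g → f · shift a g ≈ shift a (f · g)
shift-·ʳ a f g = ≈-trans (·-comm f (shift a g)) (≈-trans (shift-·ˡ a g f) (shift-cong a (·-comm g f)))

pow-+ : ∀ f m n → pow f (m +ℕ n) ≈ pow f m · pow f n
pow-+ f zero    n = ≈-sym (one-· (pow f n))
pow-+ f (suc m) n = ≈-trans (·-cong (≈-refl {f}) (pow-+ f m n)) (≈-sym (·-assoc f (pow f m) (pow f n)))

shift-shift-≡ : ∀ a b c d f → a +ℕ b ≡ c +ℕ d → shift a (shift b f) ≈ shift c (shift d f)
shift-shift-≡ a b c d f eq =
  ≈-trans (shift-+ a b f) (≈-trans (coeffwise (λ n → cong (λ s → shift s f n) eq)) (≈-sym (shift-+ c d f)))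

-1^ : ℕ → ℤ
-1^ zero    = 1ℤ
-1^ (suc n) = - -1^ n

pow-neg : ∀ f n → pow (neg f) n ≈ -1^ n *ₗ pow f n
pow-neg f zero    = coeffwise (λ k → sym (ℤₚ.*-identityˡ (one k)))
pow-neg f (suc n) = begin
  neg f · pow (neg f) n                ≈⟨ ·-cong neg≈-1*ₗ (pow-neg f n) ⟩
  (- 1ℤ *ₗ f) · (-1^ n *ₗ pow f n)     ≈⟨ *ₗ-· (- 1ℤ) f _ ⟩
  - 1ℤ *ₗ (f · (-1^ n *ₗ pow f n))     ≈⟨ *ₗ-cong (- 1ℤ) (·-*ₗ (-1^ n) f (pow f n)) ⟩
  - 1ℤ *ₗ (-1^ n *ₗ (f · pow f n))     ≈⟨ coeffwise (λ k → sign-step (-1^ n) ((f · pow f n) k)) ⟩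
  - -1^ n *ₗ (f · pow f n)             ∎
  where
  open ≈-Reasoning
  neg≈-1*ₗ : neg f ≈ - 1ℤ *ₗ f
  neg≈-1*ₗ = coeffwise (λ k → sym (ℤₚ.-1*i≡-i (f k)))
  sign-step : ∀ a b → - 1ℤ * (a * b) ≡ - a * b
  sign-step = solve-∀

-- Partitions and fixed rows

-- partitions b = 1/(q;q)_b, enumerated by the largest part x + 1.  With fuel L the
-- coefficients of q^k, k ≤ L, are already exact, since every part is positive.
partitionsᶠ : ℕ → ℕ → FPS
partitionsᶠ zero    b = one
partitionsᶠ (suc L) b = one ⊕ Σₛ b (λ x → shift (suc x) (partitionsᶠ L (suc x)))

-- Rows m_i ≥ m_{i+1} ≥ … ≥ 1 bounded by b, indexed from i, with m_n = n for some n.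
-- Once a fixed row is reached the remaining rows form an arbitrary partition.
fixedRowᶠ : ℕ → ℕ → ℕ → FPS
belowHeadᶠ : ℕ → ℕ → ℕ → FPS

fixedRowᶠ zero    i b = zeroₛ
fixedRowᶠ (suc L) i b = Σₛ b (λ x → shift (suc x) (belowHeadᶠ L i (suc x)))

belowHeadᶠ L i m = if m ≡ᵇ i then partitionsᶠ L m else fixedRowᶠ L (suc i) m

partitions : ℕ → FPS
partitions b k = partitionsᶠ k b k

fixedRow : ℕ → ℕ → FPS
fixedRow i b k = fixedRowᶠ k i b k

largestPart : ℕ → FPS
largestPart m = shift m (partitions m)

belowHead : ℕ → ℕ → FPS
belowHead i m = if m ≡ᵇ i then partitions m else fixedRow (suc i) m

fixedRowHead : ℕ → ℕ → FPS
fixedRowHead i m = shift m (belowHead i m)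

if-cong-at : ∀ c {f f′ g g′ : FPS} k → f k ≡ f′ k → g k ≡ g′ k →
  (if c then f else g) k ≡ (if c then f′ else g′) k
if-cong-at true  k eq _  = eq
if-cong-at false k _  eq = eq

remaining-fuel : ∀ {k L} x → k ≤ℕ suc L → k ∸ suc x ≤ℕ L
remaining-fuel {k} {L} x k≤L+1 = ℕₚ.m≤n+o⇒m∸n≤o k (suc x) (ℕₚ.≤-trans k≤L+1 (s≤s (ℕₚ.m≤n+m L x)))

positive-shifts-at-0 : ∀ b (F : ℕ → FPS) → Σₛ b (λ x → shift (suc x) (F x)) 0 ≡ 0ℤ
positive-shifts-at-0 b F = Σ<-zero b (λ _ _ → refl)

partitionsᶠ-stable : ∀ L L′ b k → k ≤ℕ L → k ≤ℕ L′ → partitionsᶠ L b k ≡ partitionsᶠ L′ b k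
partitionsᶠ-stable zero     zero     b k _ _ = refl
partitionsᶠ-stable zero     (suc L′) b zero _ _ = sym (cong (1ℤ +_) (positive-shifts-at-0 b (partitionsᶠ L′ ∘ suc)))
partitionsᶠ-stable (suc L)  zero     b zero _ _ = cong (1ℤ +_) (positive-shifts-at-0 b (partitionsᶠ L ∘ suc))
partitionsᶠ-stable (suc L)  (suc L′) b k k≤L k≤L′ = cong (one k +_) (Σ<-cong b λ x _ →
  shift-cong-at (suc x) (partitionsᶠ L (suc x)) (partitionsᶠ L′ (suc x)) k (λ _ →
    partitionsᶠ-stable L L′ (suc x) (k ∸ suc x) (remaining-fuel x k≤L) (remaining-fuel x k≤L′)))

partitionsᶠ-exact : ∀ L b k → k ≤ℕ L → partitionsᶠ L b k ≡ partitions b k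
partitionsᶠ-exact L b k k≤L = partitionsᶠ-stable L k b k k≤L ℕₚ.≤-refl

fixedRowᶠ-stable : ∀ L L′ i b k → k ≤ℕ L → k ≤ℕ L′ → fixedRowᶠ L i b k ≡ fixedRowᶠ L′ i b k
fixedRowᶠ-stable zero     zero     i b k _ _ = refl
fixedRowᶠ-stable zero     (suc L′) i b zero _ _ = sym (positive-shifts-at-0 b (belowHeadᶠ L′ i ∘ suc))
fixedRowᶠ-stable (suc L)  zero     i b zero _ _ = positive-shifts-at-0 b (belowHeadᶠ L i ∘ suc)
fixedRowᶠ-stable (suc L)  (suc L′) i b k k≤L k≤L′ = Σ<-cong b λ x _ →
  shift-cong-at (suc x) (belowHeadᶠ L i (suc x)) (belowHeadᶠ L′ i (suc x)) k (λ _ → if-cong-at (suc x ≡ᵇ i) (k ∸ suc x)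
    (partitionsᶠ-stable L L′ (suc x) (k ∸ suc x) (remaining-fuel x k≤L) (remaining-fuel x k≤L′))
    (fixedRowᶠ-stable L L′ (suc i) (suc x) (k ∸ suc x) (remaining-fuel x k≤L) (remaining-fuel x k≤L′)))

fixedRowᶠ-exact : ∀ L i b k → k ≤ℕ L → fixedRowᶠ L i b k ≡ fixedRow i b k
fixedRowᶠ-exact L i b k k≤L = fixedRowᶠ-stable L k i b k k≤L ℕₚ.≤-refl

belowHeadᶠ-exact : ∀ L i m k → k ≤ℕ L → belowHeadᶠ L i m k ≡ belowHead i m k
belowHeadᶠ-exact L i m k k≤L =
  if-cong-at (m ≡ᵇ i) k (partitionsᶠ-exact L m k k≤L) (fixedRowᶠ-exact L (suc i) m k k≤L)

partitions-rec : ∀ b → partitions b ≈ one ⊕ Σₛ b (λ x → largestPart (suc x))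
partitions-rec b = coeffwise rec-at
  where
  rec-at : ∀ k → partitions b k ≡ (one ⊕ Σₛ b (λ x → largestPart (suc x))) k
  rec-at zero    = sym (cong (1ℤ +_) (positive-shifts-at-0 b (partitions ∘ suc)))
  rec-at (suc k) = cong (0ℤ +_) (Σ<-cong b λ x _ →
    shift-cong-at (suc x) (partitionsᶠ k (suc x)) (partitions (suc x)) (suc k) λ _ →
    partitionsᶠ-exact k (suc x) (suc k ∸ suc x) (remaining-fuel x ℕₚ.≤-refl))

fixedRow-rec : ∀ i b → fixedRow i b ≈ Σₛ b (λ x → fixedRowHead i (suc x))
fixedRow-rec i b = coeffwise rec-at
  where
  rec-at : ∀ k → fixedRow i b k ≡ Σₛ b (λ x → fixedRowHead i (suc x)) k
  rec-at zero    = sym (positive-shifts-at-0 b (belowHead i ∘ suc))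
  rec-at (suc k) = Σ<-cong b λ x _ →
    shift-cong-at (suc x) (belowHeadᶠ k i (suc x)) (belowHead i (suc x)) (suc k) λ _ →
    belowHeadᶠ-exact k i (suc x) (suc k ∸ suc x) (remaining-fuel x ℕₚ.≤-refl)

≡⇒≈ : ∀ {f g} → f ≡ g → f ≈ g
≡⇒≈ refl = ≈-refl

partitions-0 : partitions 0 ≈ one
partitions-0 = coeffwise (λ k → trans (at (partitions-rec 0) k) (ℤₚ.+-identityʳ (one k)))

fixedRowᶠ-vanish : ∀ L i b → b <ℕ i → fixedRowᶠ L i b ≈ zeroₛ
fixedRowᶠ-vanish zero    i b b<i = ≈-refl
fixedRowᶠ-vanish (suc L) i b b<i = Σₛ-zero b λ x x<b →
  ≈-trans (shift-cong (suc x) (below x (ℕₚ.≤-<-trans x<b b<i))) (shift-zero (suc x))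
  where
  below : ∀ x → suc x <ℕ i → belowHeadᶠ L i (suc x) ≈ zeroₛ
  below x x+1<i rewrite ≢⇒≡ᵇ≡false (ℕₚ.<⇒≢ x+1<i) =
    fixedRowᶠ-vanish L (suc i) (suc x) (ℕₚ.m<n⇒m<1+n x+1<i)

fixedRow-vanish : ∀ i b → b <ℕ i → fixedRow i b ≈ zeroₛ
fixedRow-vanish i b b<i = coeffwise (λ k → at (fixedRowᶠ-vanish k i b b<i) k)

fixedRowHead-< : ∀ {i m} → m <ℕ i → fixedRowHead i m ≈ zeroₛ
fixedRowHead-< {i} {m} m<i rewrite ≢⇒≡ᵇ≡false (ℕₚ.<⇒≢ m<i) =
  ≈-trans (shift-cong m (fixedRow-vanish (suc i) m (ℕₚ.m<n⇒m<1+n m<i))) (shift-zero m)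

fixedRowHead-self : ∀ i → fixedRowHead i i ≈ largestPart i
fixedRowHead-self i rewrite ≡ᵇ-refl i = ≈-refl

fixedRowHead-> : ∀ {i m} → i <ℕ m → fixedRowHead i m ≈ shift m (fixedRow (suc i) m)
fixedRowHead-> {i} {m} i<m rewrite ≢⇒≡ᵇ≡false (ℕₚ.>⇒≢ i<m) = ≈-refl

fixedRow-from-head : ∀ j e → fixedRow (suc j) (j +ℕ suc e) ≈
  largestPart (suc j) ⊕ Σₛ e (λ y → shift (suc j +ℕ suc y) (fixedRow (suc (suc j)) (suc j +ℕ suc y)))
fixedRow-from-head j e = begin
  fixedRow i (j +ℕ suc e)
    ≈⟨ fixedRow-rec i (j +ℕ suc e) ⟩
  Σₛ (j +ℕ suc e) (fixedRowHead i ∘ suc)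
    ≈⟨ Σₛ-split j (suc e) (fixedRowHead i ∘ suc) ⟩
  Σₛ j (fixedRowHead i ∘ suc) ⊕ Σₛ (suc e) (λ y → fixedRowHead i (suc (j +ℕ y)))
    ≈⟨ ⊕-identityˡ _ (Σₛ-zero j (λ x x<j → fixedRowHead-< (s≤s x<j))) ⟩
  Σₛ (suc e) (λ y → fixedRowHead i (suc (j +ℕ y)))
    ≈⟨ Σₛ-head e (λ y → fixedRowHead i (suc (j +ℕ y))) ⟩
  fixedRowHead i (suc (j +ℕ 0)) ⊕ Σₛ e (λ y → fixedRowHead i (i +ℕ suc y))
    ≈⟨ ⊕-cong head (Σₛ-cong e (λ y _ → fixedRowHead-> {m = i +ℕ suc y} (ℕₚ.m<m+n i (s≤s z≤n)))) ⟩
  largestPart i ⊕ Σₛ e (λ y → shift (i +ℕ suc y) (fixedRow (suc i) (i +ℕ suc y)))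
    ∎
  where
  open ≈-Reasoning
  i = suc j
  head : fixedRowHead i (suc (j +ℕ 0)) ≈ largestPart i
  head = ≈-trans (≡⇒≈ (cong (fixedRowHead i ∘ suc) (ℕₚ.+-identityʳ j))) (fixedRowHead-self i)

-- The left side counts partitions with largest part m = i + d whose rows,
-- indexed from i, never meet their index.
largestPart-⊖-fixedRowHead : ∀ d j →
  largestPart (suc j +ℕ d) ⊖ fixedRowHead (suc j) (suc j +ℕ d) ≈ shift d (fixedRow (suc j) (j +ℕ d))
largestPart-⊖-fixedRowHead = <-rec P step
  where
  open ≈-Reasoning

  P : ℕ → Set
  P d = ∀ j → largestPart (suc j +ℕ d) ⊖ fixedRowHead (suc j) (suc j +ℕ d) ≈ shift d (fixedRow (suc j) (j +ℕ d))

  base : P 0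
  base j rewrite ℕₚ.+-identityʳ j = begin
    largestPart (suc j) ⊖ fixedRowHead (suc j) (suc j)  ≈⟨ ⊖-congʳ (largestPart (suc j)) (fixedRowHead-self (suc j)) ⟩
    largestPart (suc j) ⊖ largestPart (suc j)           ≈⟨ ⊖-self (largestPart (suc j)) ⟩
    zeroₛ                                              ≈⟨ fixedRow-vanish (suc j) j (ℕₚ.n<1+n j) ⟨
    fixedRow (suc j) j                                 ∎

  module Step (e : ℕ) (ih : ∀ {y} → y <ℕ suc e → P y) (j : ℕ) where
    i = suc j
    m = i +ℕ suc e

    G : ℕ → FPS
    G y = shift (suc y) (fixedRow (suc i) (i +ℕ suc y))

    F : ℕ → FPS
    F x = largestPart (suc x) ⊖ fixedRowHead (suc i) (suc x)

    F-low : ∀ x → x <ℕ i → F x ≈ largestPart (suc x)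
    F-low x x<i = ⊖-zeroʳ (largestPart (suc x)) (fixedRowHead-< (s≤s x<i))

    F-high : Σₛ (suc e) (λ y → F (i +ℕ y)) ≈ Σₛ e G
    F-high = begin
      Σₛ (suc e) (λ y → F (i +ℕ y))
        ≈⟨ Σₛ-cong (suc e) (λ y y≤e → ih y≤e i) ⟩
      Σₛ (suc e) (λ y → shift y (fixedRow (suc i) (i +ℕ y)))
        ≈⟨ Σₛ-head e (λ y → shift y (fixedRow (suc i) (i +ℕ y))) ⟩
      fixedRow (suc i) (i +ℕ 0) ⊕ Σₛ e G
        ≈⟨ ⊕-identityˡ (Σₛ e G) (fixedRow-vanish (suc i) (i +ℕ 0) (s≤s (ℕₚ.≤-reflexive (ℕₚ.+-identityʳ i)))) ⟩
      Σₛ e G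
        ∎

    excess : partitions m ⊖ fixedRow (suc i) m ≈ partitions i ⊕ Σₛ e G
    excess = begin
      partitions m ⊖ fixedRow (suc i) m
        ≈⟨ ⊖-cong (partitions-rec m) (fixedRow-rec (suc i) m) ⟩
      one ⊕ Σₛ m (largestPart ∘ suc) ⊖ Σₛ m (fixedRowHead (suc i) ∘ suc)
        ≈⟨ ⊕-⊖-assoc one (Σₛ m (largestPart ∘ suc)) (Σₛ m (fixedRowHead (suc i) ∘ suc)) ⟩
      one ⊕ (Σₛ m (largestPart ∘ suc) ⊖ Σₛ m (fixedRowHead (suc i) ∘ suc))
        ≈⟨ ⊕-congʳ one (Σₛ-⊖ m (largestPart ∘ suc) (fixedRowHead (suc i) ∘ suc)) ⟨
      one ⊕ Σₛ m F
        ≈⟨ ⊕-congʳ one (Σₛ-split i (suc e) F) ⟩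
      one ⊕ (Σₛ i F ⊕ Σₛ (suc e) (λ y → F (i +ℕ y)))
        ≈⟨ ⊕-congʳ one (⊕-cong (Σₛ-cong i F-low) F-high) ⟩
      one ⊕ (Σₛ i (largestPart ∘ suc) ⊕ Σₛ e G)
        ≈⟨ ⊕-assoc one (Σₛ i (largestPart ∘ suc)) (Σₛ e G) ⟨
      one ⊕ Σₛ i (largestPart ∘ suc) ⊕ Σₛ e G
        ≈⟨ ⊕-congˡ (Σₛ e G) (partitions-rec i) ⟨
      partitions i ⊕ Σₛ e G
        ∎

    H : ℕ → FPS
    H y = shift (i +ℕ suc y) (fixedRow (suc i) (i +ℕ suc y))

    identity : largestPart m ⊖ fixedRowHead i m ≈ shift (suc e) (fixedRow i (j +ℕ suc e))
    identity = begin
      largestPart m ⊖ fixedRowHead i m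
        ≈⟨ ⊖-congʳ (largestPart m) (fixedRowHead-> {m = m} (ℕₚ.m<m+n i (s≤s z≤n))) ⟩
      shift m (partitions m) ⊖ shift m (fixedRow (suc i) m)
        ≈⟨ shift-⊖ m (partitions m) (fixedRow (suc i) m) ⟨
      shift m (partitions m ⊖ fixedRow (suc i) m)
        ≈⟨ ≈-trans (shift-cong m excess) (shift-⊕ m (partitions i) (Σₛ e G)) ⟩
      shift m (partitions i) ⊕ shift m (Σₛ e G)
        ≈⟨ ⊕-cong (shift-shift-≡ m 0 (suc e) i (partitions i) (trans (ℕₚ.+-identityʳ m) (ℕₚ.+-comm i (suc e))))
                  (≈-trans (shift-Σₛ m e G) (Σₛ-cong e (λ y _ → shift-shift-≡ m (suc y) (suc e) (i +ℕ suc y) (fixedRow (suc i) (i +ℕ suc y)) (reorder y)))) ⟩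
      shift (suc e) (largestPart i) ⊕ Σₛ e (λ y → shift (suc e) (H y))
        ≈⟨ ≈-trans (shift-⊕ (suc e) (largestPart i) (Σₛ e H)) (⊕-congʳ (shift (suc e) (largestPart i)) (shift-Σₛ (suc e) e H)) ⟨
      shift (suc e) (largestPart i ⊕ Σₛ e H)
        ≈⟨ shift-cong (suc e) (fixedRow-from-head j e) ⟨
      shift (suc e) (fixedRow i (j +ℕ suc e))
        ∎
      where
      reorder : ∀ y → m +ℕ suc y ≡ suc e +ℕ (i +ℕ suc y)
      reorder = reorder-law i e
        where
        reorder-law : ∀ a b c → a +ℕ suc b +ℕ suc c ≡ suc b +ℕ (a +ℕ suc c)
        reorder-law = ℕ-Solver.solve-∀

  step : ∀ d → (∀ {y} → y <ℕ d → P y) → P d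
  step zero    _  = base
  step (suc e) ih = Step.identity e ih

partitions-Σ-largestPart : ∀ b → partitions b ≈ Σₛ (suc b) largestPart
partitions-Σ-largestPart b =
  ≈-trans (partitions-rec b) (≈-trans (⊕-congˡ (Σₛ b (largestPart ∘ suc)) (≈-sym partitions-0))
                                       (≈-sym (Σₛ-head b largestPart)))

-- The closed form

alternatingTerm : ℕ → ℕ → FPS
alternatingTerm n w = -1^ n *ₗ shift (n C 2) (largestPart w)

-- closedForm m = Σ_{n ≤ m} (-1)^n q^(n choose 2) q^(m-n)/(q;q)_(m-n) is the coefficient
-- of a^m in Θ₀(-a,q) · Σ_w a^w q^w/(q;q)_w.
closedForm : ℕ → FPS
closedForm m = Σₛ (suc m) (λ n → alternatingTerm n (m ∸ n))

closedForm-0 : closedForm 0 ≈ one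
closedForm-0 = coeffwise (λ k → trans (ℤₚ.+-identityˡ _) (trans (ℤₚ.*-identityˡ _) (at partitions-0 k)))

Σ-closedForm : ∀ d →
  Σₛ (suc d) closedForm ≈ Σₛ (suc d) (λ n → -1^ n *ₗ shift (n C 2) (partitions (d ∸ n)))
Σ-closedForm d = begin
  Σₛ (suc d) closedForm
    ≈⟨ coeffwise (λ k → Σ<-triangle (suc d) (λ n w → alternatingTerm n w k)) ⟩
  Σₛ (suc d) (λ n → Σₛ (suc d ∸ n) (alternatingTerm n))
    ≈⟨ Σₛ-cong (suc d) (λ n n≤d → ≈-trans (≡⇒≈ (cong (λ l → Σₛ l (alternatingTerm n)) (ℕₚ.+-∸-assoc 1 (ℕₚ.m<1+n⇒m≤n n≤d))))
                                           (column n)) ⟩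
  Σₛ (suc d) (λ n → -1^ n *ₗ shift (n C 2) (partitions (d ∸ n)))
    ∎
  where
  open ≈-Reasoning
  column : ∀ n → Σₛ (suc (d ∸ n)) (alternatingTerm n) ≈ -1^ n *ₗ shift (n C 2) (partitions (d ∸ n))
  column n = begin
    Σₛ (suc (d ∸ n)) (λ w → -1^ n *ₗ shift (n C 2) (largestPart w))   ≈⟨ *ₗ-Σₛ (-1^ n) (suc (d ∸ n)) _ ⟨
    -1^ n *ₗ Σₛ (suc (d ∸ n)) (λ w → shift (n C 2) (largestPart w))   ≈⟨ *ₗ-cong (-1^ n) (shift-Σₛ (n C 2) (suc (d ∸ n)) largestPart) ⟨
    -1^ n *ₗ shift (n C 2) (Σₛ (suc (d ∸ n)) largestPart)             ≈⟨ *ₗ-cong (-1^ n) (shift-cong (n C 2) (partitions-Σ-largestPart (d ∸ n))) ⟨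
    -1^ n *ₗ shift (n C 2) (partitions (d ∸ n))                       ∎

C2-suc : ∀ n → suc n C 2 ≡ n +ℕ n C 2
C2-suc n = trans (sym (nCk+nC[k+1]≡[n+1]C[k+1] n 1)) (cong (_+ℕ n C 2) (nC1≡n n))

C2-suc+∸ : ∀ {n d} → n ≤ℕ d → suc n C 2 +ℕ (d ∸ n) ≡ d +ℕ n C 2
C2-suc+∸ {n} {d} n≤d = begin
  suc n C 2 +ℕ (d ∸ n)      ≡⟨ cong (_+ℕ (d ∸ n)) (C2-suc n) ⟩
  n +ℕ n C 2 +ℕ (d ∸ n)     ≡⟨ swap-last n (n C 2) (d ∸ n) ⟩
  n +ℕ (d ∸ n) +ℕ n C 2     ≡⟨ cong (_+ℕ n C 2) (ℕₚ.m+[n∸m]≡n n≤d) ⟩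
  d +ℕ n C 2                ∎
  where
  open ≡-Reasoning
  swap-last : ∀ a b c → a +ℕ b +ℕ c ≡ a +ℕ c +ℕ b
  swap-last = ℕ-Solver.solve-∀

alternatingTerm-suc : ∀ {n d} → n ≤ℕ d → ∀ k →
  alternatingTerm (suc n) (d ∸ n) k ≡ - shift d (-1^ n *ₗ shift (n C 2) (partitions (d ∸ n))) k
alternatingTerm-suc {n} {d} n≤d k = begin
  - -1^ n * shift (suc n C 2) (largestPart (d ∸ n)) k
    ≡⟨ cong (- -1^ n *_) (at (shift-shift-≡ (suc n C 2) (d ∸ n) d (n C 2) P (C2-suc+∸ n≤d)) k) ⟩
  - -1^ n * shift d (shift (n C 2) P) k
    ≡⟨ ℤₚ.neg-distribˡ-* (-1^ n) _ ⟨
  - (-1^ n * shift d (shift (n C 2) P) k)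
    ≡⟨ cong -_ (at (shift-*ₗ d (-1^ n) (shift (n C 2) P)) k) ⟨
  - shift d (-1^ n *ₗ shift (n C 2) P) k
    ∎
  where
  open ≡-Reasoning
  P = partitions (d ∸ n)

closedForm-suc : ∀ d → closedForm (suc d) ≈ largestPart (suc d) ⊖ shift d (Σₛ (suc d) closedForm)
closedForm-suc d = begin
  closedForm (suc d)
    ≈⟨ Σₛ-head (suc d) (λ n → alternatingTerm n (suc d ∸ n)) ⟩
  alternatingTerm 0 (suc d) ⊕ Σₛ (suc d) (λ n → alternatingTerm (suc n) (d ∸ n))
    ≈⟨ coeffwise (λ k → cong₂ _+_ (ℤₚ.*-identityˡ (largestPart (suc d) k))
                                  (trans (Σ<-cong (suc d) (λ n n≤d → alternatingTerm-suc (ℕₚ.m<1+n⇒m≤n n≤d) k))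
                                         (Σ<-neg (suc d) (λ n → shift d (Y n) k)))) ⟩
  largestPart (suc d) ⊖ Σₛ (suc d) (λ n → shift d (Y n))
    ≈⟨ ⊖-congʳ (largestPart (suc d)) (shift-Σₛ d (suc d) Y) ⟨
  largestPart (suc d) ⊖ shift d (Σₛ (suc d) Y)
    ≈⟨ ⊖-congʳ (largestPart (suc d)) (shift-cong d (Σ-closedForm d)) ⟨
  largestPart (suc d) ⊖ shift d (Σₛ (suc d) closedForm)
    ∎
  where
  open ≈-Reasoning
  Y : ℕ → FPS
  Y n = -1^ n *ₗ shift (n C 2) (partitions (d ∸ n))

⊖-solve : ∀ {f g h} → h ≈ f ⊖ g → f ≈ g ⊕ h
⊖-solve {f} {g} {h} p = coeffwise λ k → trans (rearrange (f k) (g k)) (cong (g k +_) (sym (at p k)))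
  where
  rearrange : ∀ a b → a ≡ b + (a - b)
  rearrange = solve-∀

⊖-flip : ∀ f {g h} → f ⊖ g ≈ h → g ≈ f ⊖ h
⊖-flip f {g} {h} p = coeffwise λ k → trans (rearrange (f k) (g k)) (cong (λ x → f k - x) (at p k))
  where
  rearrange : ∀ a b → b ≡ a - (a - b)
  rearrange = solve-∀

fixedRowHead-1 : ∀ d → fixedRowHead 1 (suc d) ≈ largestPart (suc d) ⊖ shift d (fixedRow 1 d)
fixedRowHead-1 d = ⊖-flip (largestPart (suc d)) (largestPart-⊖-fixedRowHead d 0)

largestPart-1 : largestPart 1 ≈ Σₛ 2 closedForm
largestPart-1 = ⊖-solve (closedForm-suc 0)

fixedRow-1 : ∀ d → fixedRow 1 (suc d) ≈ Σₛ (suc (suc d)) closedForm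
fixedRow-1 zero = begin
  fixedRow 1 1        ≈⟨ fixedRow-rec 1 1 ⟩
  Σₛ 1 (fixedRowHead 1 ∘ suc)   ≈⟨ coeffwise (λ k → ℤₚ.+-identityˡ (fixedRowHead 1 1 k)) ⟩
  fixedRowHead 1 1    ≈⟨ fixedRowHead-self 1 ⟩
  largestPart 1       ≈⟨ largestPart-1 ⟩
  Σₛ 2 closedForm     ∎
  where open ≈-Reasoning
fixedRow-1 (suc d) = begin
  fixedRow 1 (suc (suc d))
    ≈⟨ fixedRow-rec 1 (suc (suc d)) ⟩
  Σₛ (suc d) (fixedRowHead 1 ∘ suc) ⊕ fixedRowHead 1 (suc (suc d))
    ≈⟨ ⊕-cong (≈-sym (fixedRow-rec 1 (suc d))) (fixedRowHead-1 (suc d)) ⟩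
  fixedRow 1 (suc d) ⊕ (largestPart (suc (suc d)) ⊖ shift (suc d) (fixedRow 1 (suc d)))
    ≈⟨ ⊕-cong (fixedRow-1 d) (⊖-congʳ (largestPart (suc (suc d))) (shift-cong (suc d) (fixedRow-1 d))) ⟩
  S ⊕ (largestPart (suc (suc d)) ⊖ shift (suc d) S)
    ≈⟨ ⊕-congʳ S (closedForm-suc (suc d)) ⟨
  Σₛ (suc (suc (suc d))) closedForm
    ∎
  where
  open ≈-Reasoning
  S = Σₛ (suc (suc d)) closedForm

fixedRowHead-1-1 : fixedRowHead 1 1 ≈ Σₛ 2 closedForm
fixedRowHead-1-1 = ≈-trans (fixedRowHead-self 1) largestPart-1

fixedRowHead-1-2+ : ∀ d → fixedRowHead 1 (suc (suc d)) ≈ closedForm (suc (suc d))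
fixedRowHead-1-2+ d = begin
  fixedRowHead 1 (suc (suc d))
    ≈⟨ fixedRowHead-1 (suc d) ⟩
  largestPart (suc (suc d)) ⊖ shift (suc d) (fixedRow 1 (suc d))
    ≈⟨ ⊖-congʳ (largestPart (suc (suc d))) (shift-cong (suc d) (fixedRow-1 d)) ⟩
  largestPart (suc (suc d)) ⊖ shift (suc d) (Σₛ (suc (suc d)) closedForm)
    ≈⟨ closedForm-suc (suc d) ⟨
  closedForm (suc (suc d))
    ∎
  where open ≈-Reasoning

Θ₀-term : FPS → ℕ → FPS
Θ₀-term y n = shift (n C 2) (pow y n)

C2-large : ∀ r n → suc (suc r) ≤ℕ n → r <ℕ n C 2
C2-large r (suc n) (s≤s r+1≤n) =
  ℕₚ.<-≤-trans r+1≤n (ℕₚ.≤-trans (ℕₚ.m≤m+n n (n C 2)) (ℕₚ.≤-reflexive (sym (C2-suc n))))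

Θ₀at-Σₛ : ∀ y K r → suc (suc r) ≤ℕ K → Σₛ K (Θ₀-term y) r ≡ Θ₀at y r
Θ₀at-Σₛ y K r r+2≤K = begin
  Σ< K (λ n → Θ₀-term y n r)
    ≡⟨ cong (λ l → Σ< l (λ n → Θ₀-term y n r)) (ℕₚ.m+[n∸m]≡n r+2≤K) ⟨
  Σ< (suc (suc r) +ℕ (K ∸ suc (suc r))) (λ n → Θ₀-term y n r)
    ≡⟨ Σ<-split (suc (suc r)) (K ∸ suc (suc r)) (λ n → Θ₀-term y n r) ⟩
  Σ< (suc (suc r)) (λ n → Θ₀-term y n r) + Σ< (K ∸ suc (suc r)) (λ j → Θ₀-term y (suc (suc r) +ℕ j) r)
    ≡⟨ cong (Σ< (suc (suc r)) (λ n → Θ₀-term y n r) +_) (Σ<-zero (K ∸ suc (suc r)) λ j _ →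
         shift-< ((suc (suc r) +ℕ j) C 2) (pow y (suc (suc r) +ℕ j)) (C2-large r _ (ℕₚ.m≤m+n (suc (suc r)) j))) ⟩
  Σ< (suc (suc r)) (λ n → Θ₀-term y n r) + 0ℤ
    ≡⟨ ℤₚ.+-identityʳ _ ⟩
  Σ< (suc (suc r)) (λ n → Θ₀-term y n r)
    ≡⟨ Σ≤-Σ< (suc r) (λ n → Θ₀-term y n r) ⟨
  Θ₀at y r
    ∎
  where open ≡-Reasoning

module _ (ξ : FPS) where

  weighted : ℕ → FPS
  weighted w = largestPart w · pow ξ w

  alternatingTerm-· : ∀ n w → alternatingTerm n w · pow ξ (w +ℕ n) ≈ weighted w · Θ₀-term (neg ξ) n
  alternatingTerm-· n w = begin
    (-1^ n *ₗ shift (n C 2) (largestPart w)) · pow ξ (w +ℕ n)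
      ≈⟨ *ₗ-· (-1^ n) _ _ ⟩
    -1^ n *ₗ (shift (n C 2) (largestPart w) · pow ξ (w +ℕ n))
      ≈⟨ *ₗ-cong (-1^ n) (shift-·ˡ (n C 2) (largestPart w) (pow ξ (w +ℕ n))) ⟩
    -1^ n *ₗ shift (n C 2) (largestPart w · pow ξ (w +ℕ n))
      ≈⟨ *ₗ-cong (-1^ n) (shift-cong (n C 2) (·-cong (≈-refl {largestPart w}) (pow-+ ξ w n))) ⟩
    -1^ n *ₗ shift (n C 2) (largestPart w · (pow ξ w · pow ξ n))
      ≈⟨ *ₗ-cong (-1^ n) (shift-cong (n C 2) (·-assoc (largestPart w) (pow ξ w) (pow ξ n))) ⟨
    -1^ n *ₗ shift (n C 2) (weighted w · pow ξ n)
      ≈⟨ shift-*ₗ (n C 2) (-1^ n) (weighted w · pow ξ n) ⟨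
    shift (n C 2) (-1^ n *ₗ (weighted w · pow ξ n))
      ≈⟨ shift-cong (n C 2) (≈-trans (≈-sym (·-*ₗ (-1^ n) (weighted w) (pow ξ n)))
                                          (·-cong (≈-refl {weighted w}) (≈-sym (pow-neg ξ n)))) ⟩
    shift (n C 2) (weighted w · pow (neg ξ) n)
      ≈⟨ shift-·ʳ (n C 2) (weighted w) (pow (neg ξ) n) ⟨
    weighted w · Θ₀-term (neg ξ) n
      ∎
    where open ≈-Reasoning

  closedForm-· : ∀ m → closedForm m · pow ξ m ≈ Σₛ (suc m) (λ w → weighted w · Θ₀-term (neg ξ) (m ∸ w))
  closedForm-· m = begin
    closedForm m · pow ξ m
      ≈⟨ Σₛ-· (suc m) (λ n → alternatingTerm n (m ∸ n)) (pow ξ m) ⟩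
    Σₛ (suc m) (λ n → alternatingTerm n (m ∸ n) · pow ξ m)
      ≈⟨ Σₛ-cong (suc m) (λ n n≤m → ≈-trans (·-cong (≈-refl {alternatingTerm n (m ∸ n)})
                                                     (≡⇒≈ (cong (pow ξ) (sym (ℕₚ.m∸n+n≡m (ℕₚ.m<1+n⇒m≤n n≤m))))))
                                            (alternatingTerm-· n (m ∸ n))) ⟩
    Σₛ (suc m) (λ n → weighted (m ∸ n) · Θ₀-term (neg ξ) n)
      ≈⟨ coeffwise (λ k → Σ<-reverse (suc m) (λ n → (weighted (m ∸ n) · Θ₀-term (neg ξ) n) k)) ⟩
    Σₛ (suc m) (λ w → weighted (m ∸ (m ∸ w)) · Θ₀-term (neg ξ) (m ∸ w))
      ≈⟨ Σₛ-cong (suc m) (λ w w≤m → ≡⇒≈ (cong (λ v → weighted v · Θ₀-term (neg ξ) (m ∸ w))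
                                                  (ℕₚ.m∸[m∸n]≡n (ℕₚ.m<1+n⇒m≤n w≤m)))) ⟩
    Σₛ (suc m) (λ w → weighted w · Θ₀-term (neg ξ) (m ∸ w))
      ∎
    where open ≈-Reasoning

  Σ-closedForm-· : ∀ M → Σₛ (suc M) (λ m → closedForm m · pow ξ m)
                       ≈ Σₛ (suc M) (λ w → weighted w · Σₛ (suc M ∸ w) (Θ₀-term (neg ξ)))
  Σ-closedForm-· M = begin
    Σₛ (suc M) (λ m → closedForm m · pow ξ m)
      ≈⟨ Σₛ-cong (suc M) (λ m _ → closedForm-· m) ⟩
    Σₛ (suc M) (λ m → Σₛ (suc m) (λ w → weighted w · Θ₀-term (neg ξ) (m ∸ w)))
      ≈⟨ coeffwise (λ k → Σ<-triangle (suc M) (λ w n → (weighted w · Θ₀-term (neg ξ) n) k)) ⟩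
    Σₛ (suc M) (λ w → Σₛ (suc M ∸ w) (λ n → weighted w · Θ₀-term (neg ξ) n))
      ≈⟨ Σₛ-cong (suc M) (λ w _ → ·-Σₛ (weighted w) (suc M ∸ w) (Θ₀-term (neg ξ))) ⟨
    Σₛ (suc M) (λ w → weighted w · Σₛ (suc M ∸ w) (Θ₀-term (neg ξ)))
      ∎
    where open ≈-Reasoning

  weighted-< : ∀ {w k} → k <ℕ w → weighted w k ≡ 0ℤ
  weighted-< {w} {k} k<w =
    trans (at (shift-·ˡ w (partitions w) (pow ξ w)) k) (shift-< w (partitions w · pow ξ w) k<w)

  module _ (Θ₀-root : ∀ N → Θ₀at (neg ξ) N ≡ 0ℤ) where

    weighted-·-Θ₀-vanishes : ∀ N w → (weighted w · Σₛ (suc (suc N) ∸ w) (Θ₀-term (neg ξ))) N ≡ 0ℤ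
    weighted-·-Θ₀-vanishes N w = trans (·-coeff (weighted w) Θ-sum N) (Σ<-zero (suc N) term-vanishes)
      where
      Θ-sum = Σₛ (suc (suc N) ∸ w) (Θ₀-term (neg ξ))
      term-vanishes : ∀ k → k <ℕ suc N → weighted w k * Θ-sum (N ∸ k) ≡ 0ℤ
      term-vanishes k k≤N with ℕₚ.≤-<-connex w k
      ... | inj₂ k<w = cong (_* Θ-sum (N ∸ k)) (weighted-< k<w)
      ... | inj₁ w≤k = trans (cong (weighted w k *_) (trans (Θ₀at-Σₛ (neg ξ) _ (N ∸ k) long-enough) (Θ₀-root (N ∸ k))))
                             (ℤₚ.*-zeroʳ (weighted w k))
        where
        long-enough : suc (suc (N ∸ k)) ≤ℕ suc (suc N) ∸ w
        long-enough = ℕₚ.≤-trans (s≤s (s≤s (ℕₚ.∸-monoʳ-≤ N w≤k)))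
                        (ℕₚ.≤-reflexive (sym (ℕₚ.+-∸-assoc 2 (ℕₚ.≤-trans w≤k (ℕₚ.m<1+n⇒m≤n k≤N)))))

    closedForm-series-vanishes : ∀ N → Σₛ (suc (suc N)) (λ m → closedForm m · pow ξ m) N ≡ 0ℤ
    closedForm-series-vanishes N =
      trans (at (Σ-closedForm-· (suc N)) N) (Σ<-zero (suc (suc N)) (λ w _ → weighted-·-Θ₀-vanishes N w))

-- Counting Ferrers diagrams

𝟙 : Bool → ℤ
𝟙 true  = 1ℤ
𝟙 false = 0ℤ

𝟙-∧ : ∀ a b → 𝟙 (a ∧ b) ≡ 𝟙 a * 𝟙 b
𝟙-∧ true  b = sym (ℤₚ.*-identityˡ (𝟙 b))
𝟙-∧ false b = refl

if-then-0 : ∀ b v → (if b then v else 0ℤ) ≡ 𝟙 b * v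
if-then-0 true  v = sym (ℤₚ.*-identityˡ v)
if-then-0 false v = refl

𝟙-0≡ᵇ : ∀ k → 𝟙 (0 ≡ᵇ k) ≡ one k
𝟙-0≡ᵇ zero    = refl
𝟙-0≡ᵇ (suc k) = refl

𝟙-+≡ᵇ : ∀ x a v → 𝟙 (x +ℕ a ≡ᵇ v) ≡ 𝟙 (x ≤ᵇ v) * 𝟙 (a ≡ᵇ v ∸ x)
𝟙-+≡ᵇ zero    a v       = sym (ℤₚ.*-identityˡ _)
𝟙-+≡ᵇ (suc x) a zero    = refl
𝟙-+≡ᵇ (suc x) a (suc v) = trans (𝟙-+≡ᵇ x a v) (cong (λ b → 𝟙 b * 𝟙 (a ≡ᵇ v ∸ x)) (≤ᵇ-suc x v))
  where
  ≤ᵇ-suc : ∀ x v → (x ≤ᵇ v) ≡ (suc x ≤ᵇ suc v)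
  ≤ᵇ-suc zero    v = refl
  ≤ᵇ-suc (suc x) v = refl

Σ<-δ-< : ∀ n u (g : ℕ → ℤ) → u <ℕ n → Σ< n (λ v → 𝟙 (u ≡ᵇ v) * g v) ≡ g u
Σ<-δ-≥ : ∀ n u (g : ℕ → ℤ) → n ≤ℕ u → Σ< n (λ v → 𝟙 (u ≡ᵇ v) * g v) ≡ 0ℤ

Σ<-δ-< (suc n) u g u<n+1 with ℕₚ.m<1+n⇒m<n∨m≡n u<n+1
... | inj₁ u<n = begin
  Σ< n (λ v → 𝟙 (u ≡ᵇ v) * g v) + 𝟙 (u ≡ᵇ n) * g n  ≡⟨ cong₂ _+_ (Σ<-δ-< n u g u<n) (cong (λ b → 𝟙 b * g n) (≢⇒≡ᵇ≡false (ℕₚ.<⇒≢ u<n))) ⟩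
  g u + 0ℤ * g n                                    ≡⟨ ℤₚ.+-identityʳ (g u) ⟩
  g u                                               ∎
  where open ≡-Reasoning
... | inj₂ refl = begin
  Σ< u (λ v → 𝟙 (u ≡ᵇ v) * g v) + 𝟙 (u ≡ᵇ u) * g u  ≡⟨ cong₂ _+_ (Σ<-δ-≥ u u g ℕₚ.≤-refl) (cong (λ b → 𝟙 b * g u) (≡ᵇ-refl u)) ⟩
  0ℤ + 1ℤ * g u                                     ≡⟨ trans (ℤₚ.+-identityˡ _) (ℤₚ.*-identityˡ (g u)) ⟩
  g u                                               ∎
  where open ≡-Reasoning

Σ<-δ-≥ zero    u g _       = refl
Σ<-δ-≥ (suc n) u g n+1≤u =
  cong₂ _+_ (Σ<-δ-≥ n u g (ℕₚ.<⇒≤ n+1≤u)) (cong (λ b → 𝟙 b * g n) (≢⇒≡ᵇ≡false (ℕₚ.>⇒≢ n+1≤u)))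

shift-as-Σ< : ∀ a f N → shift a f N ≡ Σ< (suc N) (λ v → 𝟙 (a ≡ᵇ v) * f (N ∸ v))
shift-as-Σ< a f N with ℕₚ.≤-<-connex a N
... | inj₁ a≤N = trans (shift-≥ a f a≤N) (sym (Σ<-δ-< (suc N) a (λ v → f (N ∸ v)) (s≤s a≤N)))
... | inj₂ N<a = trans (shift-< a f N<a) (sym (Σ<-δ-≥ (suc N) a (λ v → f (N ∸ v)) N<a))

sumOver-allLists-suc : ∀ B L (f : List ℕ → ℤ) →
  sumOver (allLists B (suc L)) f ≡ f [] + Σ< (suc B) (λ x → sumOver (allLists B L) (λ D → f (x ∷ D)))
sumOver-allLists-suc B L f = begin
  sumOver (allLists B (suc L)) f
    ≡⟨ by-length (suc L) f ⟩
  Σ< (suc (suc L)) (λ l → sumOver (listsOfLength B l) f)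
    ≡⟨ Σ<-head (suc L) _ ⟩
  (f [] + 0ℤ) + Σ< (suc L) (λ l → sumOver (listsOfLength B (suc l)) f)
    ≡⟨ cong₂ _+_ (ℤₚ.+-identityʳ (f [])) (Σ<-cong (suc L) (λ l _ → by-head l)) ⟩
  f [] + Σ< (suc L) (λ l → Σ< (suc B) (λ x → sumOver (listsOfLength B l) (λ D → f (x ∷ D))))
    ≡⟨ cong (f [] +_) (Σ<-swap (suc L) (suc B) _) ⟩
  f [] + Σ< (suc B) (λ x → Σ< (suc L) (λ l → sumOver (listsOfLength B l) (λ D → f (x ∷ D))))
    ≡⟨ cong (f [] +_) (Σ<-cong (suc B) (λ x _ → by-length L (λ D → f (x ∷ D)))) ⟨
  f [] + Σ< (suc B) (λ x → sumOver (allLists B L) (λ D → f (x ∷ D)))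
    ∎
  where
  open ≡-Reasoning
  by-length : ∀ L g → sumOver (allLists B L) g ≡ Σ< (suc L) (λ l → sumOver (listsOfLength B l) g)
  by-length L g =
    trans (sumOver-concatMap (listsOfLength B) (upTo (suc L)) g) (sumOver-applyUpTo (suc L) id _)
  by-head : ∀ l → sumOver (listsOfLength B (suc l)) f ≡ Σ< (suc B) (λ x → sumOver (listsOfLength B l) (λ D → f (x ∷ D)))
  by-head l = trans (sumOver-concatMap (λ x → map (x ∷_) (listsOfLength B l)) (upTo (suc B)) f)
                (trans (sumOver-applyUpTo (suc B) id _)
                       (Σ<-cong (suc B) (λ x _ → sumOver-map (x ∷_) (listsOfLength B l) f)))

rowsBelow : ℕ → List ℕ → Bool
rowsBelow b []      = true
rowsBelow b (x ∷ D) = (1 ≤ᵇ x) ∧ (x ≤ᵇ b) ∧ rowsBelow x D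

isFerrers-∷ : ∀ x D → isFerrers (x ∷ D) ≡ (1 ≤ᵇ x) ∧ rowsBelow x D
isFerrers-∷ x D = trans (Boolₚ.∧-assoc (1 ≤ᵇ x) (allPositive D) _) (cong ((1 ≤ᵇ x) ∧_) (tail-rows x D))
  where
  tail-rows : ∀ x D → allPositive D ∧ weaklyDecreasing (x ∷ D) ≡ rowsBelow x D
  tail-rows x []      = refl
  tail-rows x (y ∷ D) with 1 ≤ᵇ y | y ≤ᵇ x
  ... | false | _     = refl
  ... | true  | true  = tail-rows y D
  ... | true  | false = Boolₚ.∧-zeroʳ (allPositive D)

listGF : ℕ → ℕ → (List ℕ → Bool) → FPS
listGF B L p k = sumOver (allLists B L) (λ D → 𝟙 (p D) * 𝟙 (area D ≡ᵇ k))

listGF-cong : ∀ B L {p q : List ℕ → Bool} → (∀ D → p D ≡ q D) → listGF B L p ≈ listGF B L q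
listGF-cong B L eq = coeffwise (λ k → sumOver-cong (allLists B L) (λ D → cong (λ b → 𝟙 b * _) (eq D)))

listGF-∧ : ∀ B L c p → listGF B L (λ D → c ∧ p D) ≈ 𝟙 c *ₗ listGF B L p
listGF-∧ B L c p = coeffwise λ k →
  trans (sumOver-cong (allLists B L) (λ D → trans (cong (_* 𝟙 (area D ≡ᵇ k)) (𝟙-∧ c (p D)))
                                                  (ℤₚ.*-assoc (𝟙 c) (𝟙 (p D)) _)))
        (sumOver-*ˡ (allLists B L) (𝟙 c) _)

sumOver-area-shift : ∀ {A : Set} (Ds : List A) (c : A → ℤ) (area′ : A → ℕ) x v →
  sumOver Ds (λ D → c D * 𝟙 (x +ℕ area′ D ≡ᵇ v))
    ≡ shift x (λ k → sumOver Ds (λ D → c D * 𝟙 (area′ D ≡ᵇ k))) v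
sumOver-area-shift Ds c area′ x v = begin
  sumOver Ds (λ D → c D * 𝟙 (x +ℕ area′ D ≡ᵇ v))
    ≡⟨ sumOver-cong Ds (λ D → trans (cong (c D *_) (𝟙-+≡ᵇ x (area′ D) v)) (swap-front (c D) (𝟙 (x ≤ᵇ v)) (𝟙 (area′ D ≡ᵇ v ∸ x)))) ⟩
  sumOver Ds (λ D → 𝟙 (x ≤ᵇ v) * (c D * 𝟙 (area′ D ≡ᵇ v ∸ x)))
    ≡⟨ sumOver-*ˡ Ds (𝟙 (x ≤ᵇ v)) _ ⟩
  𝟙 (x ≤ᵇ v) * sumOver Ds (λ D → c D * 𝟙 (area′ D ≡ᵇ v ∸ x))
    ≡⟨ if-then-0 (x ≤ᵇ v) _ ⟨
  shift x (λ k → sumOver Ds (λ D → c D * 𝟙 (area′ D ≡ᵇ k))) v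
    ∎
  where
  open ≡-Reasoning
  swap-front : ∀ a b d → a * (b * d) ≡ b * (a * d)
  swap-front = solve-∀

listGF-suc : ∀ B L p k → listGF B (suc L) p k
  ≡ 𝟙 (p []) * one k + Σ< (suc B) (λ x → shift x (listGF B L (λ D → p (x ∷ D))) k)
listGF-suc B L p k =
  trans (sumOver-allLists-suc B L (λ D → 𝟙 (p D) * 𝟙 (area D ≡ᵇ k)))
        (cong₂ _+_ (cong (𝟙 (p []) *_) (𝟙-0≡ᵇ k))
                   (Σ<-cong (suc B) (λ x _ → sumOver-area-shift (allLists B L) (λ D → 𝟙 (p (x ∷ D))) area x k)))

Σ<-positive-below : ∀ B b (G : ℕ → ℤ) → b ≤ℕ B →
  Σ< (suc B) (λ x → 𝟙 (1 ≤ᵇ x) * (𝟙 (x ≤ᵇ b) * G x)) ≡ Σ< b (G ∘ suc)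
Σ<-positive-below B b G b≤B = begin
  Σ< (suc B) (λ x → 𝟙 (1 ≤ᵇ x) * (𝟙 (x ≤ᵇ b) * G x))
    ≡⟨ trans (Σ<-head B _) (ℤₚ.+-identityˡ _) ⟩
  Σ< B (λ y → 1ℤ * (𝟙 (suc y ≤ᵇ b) * G (suc y)))
    ≡⟨ cong (λ l → Σ< l (λ y → 1ℤ * (𝟙 (suc y ≤ᵇ b) * G (suc y)))) (ℕₚ.m+[n∸m]≡n b≤B) ⟨
  Σ< (b +ℕ (B ∸ b)) (λ y → 1ℤ * (𝟙 (suc y ≤ᵇ b) * G (suc y)))
    ≡⟨ Σ<-split b (B ∸ b) _ ⟩
  Σ< b (λ y → 1ℤ * (𝟙 (suc y ≤ᵇ b) * G (suc y))) + Σ< (B ∸ b) (λ j → 1ℤ * (𝟙 (suc (b +ℕ j) ≤ᵇ b) * G (suc (b +ℕ j))))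
    ≡⟨ cong₂ _+_ (Σ<-cong b (λ y y<b → trans (ℤₚ.*-identityˡ _) (trans (cong (λ c → 𝟙 c * G (suc y)) (≤⇒≤ᵇ≡true y<b))
                                                                        (ℤₚ.*-identityˡ (G (suc y))))))
                 (Σ<-zero (B ∸ b) (λ j _ → cong (λ c → 1ℤ * (𝟙 c * G (suc (b +ℕ j)))) (>⇒≤ᵇ≡false (s≤s (ℕₚ.m≤m+n b j))))) ⟩
  Σ< b (G ∘ suc) + 0ℤ
    ≡⟨ ℤₚ.+-identityʳ _ ⟩
  Σ< b (G ∘ suc)
    ∎
  where open ≡-Reasoning

listGF-headed : ∀ B L b (q : ℕ → List ℕ → Bool) k → b ≤ℕ B →
  Σ< (suc B) (λ x → shift x (listGF B L (λ D → (1 ≤ᵇ x) ∧ (x ≤ᵇ b) ∧ q x D)) k)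
    ≡ Σ< b (λ y → shift (suc y) (listGF B L (q (suc y))) k)
listGF-headed B L b q k b≤B =
  trans (Σ<-cong (suc B) (λ x _ → at (guards x) k))
        (Σ<-positive-below B b (λ x → shift x (listGF B L (q x)) k) b≤B)
  where
  guards : ∀ x → shift x (listGF B L (λ D → (1 ≤ᵇ x) ∧ (x ≤ᵇ b) ∧ q x D))
                 ≈ 𝟙 (1 ≤ᵇ x) *ₗ 𝟙 (x ≤ᵇ b) *ₗ shift x (listGF B L (q x))
  guards x = begin
    shift x (listGF B L (λ D → (1 ≤ᵇ x) ∧ (x ≤ᵇ b) ∧ q x D))
      ≈⟨ shift-cong x (listGF-∧ B L (1 ≤ᵇ x) (λ D → (x ≤ᵇ b) ∧ q x D)) ⟩
    shift x (𝟙 (1 ≤ᵇ x) *ₗ listGF B L (λ D → (x ≤ᵇ b) ∧ q x D))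
      ≈⟨ shift-*ₗ x (𝟙 (1 ≤ᵇ x)) (listGF B L (λ D → (x ≤ᵇ b) ∧ q x D)) ⟩
    𝟙 (1 ≤ᵇ x) *ₗ shift x (listGF B L (λ D → (x ≤ᵇ b) ∧ q x D))
      ≈⟨ *ₗ-cong (𝟙 (1 ≤ᵇ x)) (≈-trans (shift-cong x (listGF-∧ B L (x ≤ᵇ b) (q x))) (shift-*ₗ x (𝟙 (x ≤ᵇ b)) (listGF B L (q x)))) ⟩
    𝟙 (1 ≤ᵇ x) *ₗ 𝟙 (x ≤ᵇ b) *ₗ shift x (listGF B L (q x))
      ∎
    where open ≈-Reasoning

partitions-count : ∀ B L b k → b ≤ℕ B → listGF B L (rowsBelow b) k ≡ partitionsᶠ L b k
partitions-count B zero    b k _   = trans (ℤₚ.+-identityʳ _) (trans (ℤₚ.*-identityˡ _) (𝟙-0≡ᵇ k))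
partitions-count B (suc L) b k b≤B =
  trans (listGF-suc B L (rowsBelow b) k)
        (cong₂ _+_ (ℤₚ.*-identityˡ (one k))
                   (trans (listGF-headed B L b rowsBelow k b≤B)
                          (Σ<-cong b (λ y y<b → shift-cong-at (suc y) (listGF B L (rowsBelow (suc y))) (partitionsᶠ L (suc y)) k (λ _ →
                             partitions-count B L (suc y) (k ∸ suc y) (ℕₚ.≤-trans y<b b≤B))))))

fixedRowBelow : ℕ → ℕ → List ℕ → Bool
fixedRowBelow i b D = rowsBelow b D ∧ hasFixedFrom i D

belowHeadPred : ℕ → ℕ → List ℕ → Bool
belowHeadPred i x D = rowsBelow x D ∧ (if x ≡ᵇ i then true else hasFixedFrom (suc i) D)

fixedRow-count : ∀ B L i b k → b ≤ℕ B → listGF B L (fixedRowBelow i b) k ≡ fixedRowᶠ L i b k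
belowHead-count : ∀ B L i x k → x ≤ℕ B → listGF B L (belowHeadPred i x) k ≡ belowHeadᶠ L i x k

fixedRow-count B zero    i b k _   = refl
fixedRow-count B (suc L) i b k b≤B = begin
  listGF B (suc L) (fixedRowBelow i b) k
    ≡⟨ listGF-suc B L (fixedRowBelow i b) k ⟩
  0ℤ + Σ< (suc B) (λ x → shift x (listGF B L (λ D → fixedRowBelow i b (x ∷ D))) k)
    ≡⟨ ℤₚ.+-identityˡ _ ⟩
  Σ< (suc B) (λ x → shift x (listGF B L (λ D → fixedRowBelow i b (x ∷ D))) k)
    ≡⟨ Σ<-cong (suc B) (λ x _ → at (shift-cong x (listGF-cong B L (regroup x))) k) ⟩
  Σ< (suc B) (λ x → shift x (listGF B L (λ D → (1 ≤ᵇ x) ∧ (x ≤ᵇ b) ∧ belowHeadPred i x D)) k)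
    ≡⟨ listGF-headed B L b (belowHeadPred i) k b≤B ⟩
  Σ< b (λ y → shift (suc y) (listGF B L (belowHeadPred i (suc y))) k)
    ≡⟨ Σ<-cong b (λ y y<b → shift-cong-at (suc y) (listGF B L (belowHeadPred i (suc y))) (belowHeadᶠ L i (suc y)) k (λ _ →
         belowHead-count B L i (suc y) (k ∸ suc y) (ℕₚ.≤-trans y<b b≤B))) ⟩
  fixedRowᶠ (suc L) i b k
    ∎
  where
  open ≡-Reasoning
  regroup : ∀ x D → fixedRowBelow i b (x ∷ D) ≡ (1 ≤ᵇ x) ∧ (x ≤ᵇ b) ∧ belowHeadPred i x D
  regroup x D = trans (Boolₚ.∧-assoc (1 ≤ᵇ x) _ _) (cong ((1 ≤ᵇ x) ∧_) (Boolₚ.∧-assoc (x ≤ᵇ b) _ _))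

belowHead-count B L i x k x≤B with x ≡ᵇ i
... | true  = trans (listGF-cong B L (λ D → Boolₚ.∧-identityʳ (rowsBelow x D)) .at k) (partitions-count B L x k x≤B)
... | false = fixedRow-count B L (suc i) x k x≤B

ferrersTerm : FPS → ℕ → List ℕ → ℤ
ferrersTerm y N D = if isFerrers D ∧ hasFixedRow D ∧ (area D ≤ᵇ N)
                    then shift (area D) (pow y (width D)) N
                    else 0ℤ

shift-guarded : ∀ c a f N → (if c ∧ (a ≤ᵇ N) then shift a f N else 0ℤ) ≡ 𝟙 c * shift a f N
shift-guarded false a f N = refl
shift-guarded true  a f N with a ≤ᵇ N
... | true  = sym (ℤₚ.*-identityˡ _)
... | false = refl

ferrersTerm-∷ : ∀ ξ N y D →
  ferrersTerm ξ N (suc y ∷ D) ≡ 𝟙 (belowHeadPred 1 (suc y) D) * shift (suc y +ℕ area D) (pow ξ (suc y)) N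
ferrersTerm-∷ ξ N y D = begin
  ferrersTerm ξ N (x ∷ D)
    ≡⟨ cong (λ c → if c ∧ hasFixedRow (x ∷ D) ∧ (x +ℕ area D ≤ᵇ N) then S else 0ℤ) (isFerrers-∷ x D) ⟩
  (if rowsBelow x D ∧ hasFixedRow (x ∷ D) ∧ (x +ℕ area D ≤ᵇ N) then S else 0ℤ)
    ≡⟨ cong (λ c → if c then S else 0ℤ) (Boolₚ.∧-assoc (rowsBelow x D) _ _) ⟨
  (if belowHeadPred 1 x D ∧ (x +ℕ area D ≤ᵇ N) then S else 0ℤ)
    ≡⟨ shift-guarded (belowHeadPred 1 x D) (x +ℕ area D) (pow ξ x) N ⟩
  𝟙 (belowHeadPred 1 x D) * S
    ∎
  where
  open ≡-Reasoning
  x = suc y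
  S = shift (x +ℕ area D) (pow ξ x) N

module _ (ξ : FPS) (L y : ℕ) (y<N : y <ℕ suc L) where
  private
    N = suc L
    x = suc y
    Ds = allLists N L
    c : List ℕ → ℤ
    c D = 𝟙 (belowHeadPred 1 x D)

  head-count : ∀ v → v ≤ℕ N → sumOver Ds (λ D → c D * 𝟙 (x +ℕ area D ≡ᵇ v)) ≡ fixedRowHead 1 x v
  head-count v v≤N = begin
    sumOver Ds (λ D → c D * 𝟙 (x +ℕ area D ≡ᵇ v))
      ≡⟨ sumOver-area-shift Ds c area x v ⟩
    shift x (listGF N L (belowHeadPred 1 x)) v
      ≡⟨ shift-cong-at x (listGF N L (belowHeadPred 1 x)) (belowHeadᶠ L 1 x) v (λ _ → belowHead-count N L 1 x (v ∸ x) y<N) ⟩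
    shift x (belowHeadᶠ L 1 x) v
      ≡⟨ shift-cong-at x (belowHeadᶠ L 1 x) (belowHead 1 x) v (λ _ → belowHeadᶠ-exact L 1 x (v ∸ x) (remaining-fuel y v≤N)) ⟩
    fixedRowHead 1 x v
      ∎
    where open ≡-Reasoning

  ferrers-by-head : sumOver Ds (λ D → ferrersTerm ξ N (x ∷ D)) ≡ (fixedRowHead 1 x · pow ξ x) N
  ferrers-by-head = begin
    sumOver Ds (λ D → ferrersTerm ξ N (x ∷ D))
      ≡⟨ sumOver-cong Ds (ferrersTerm-∷ ξ N y) ⟩
    sumOver Ds (λ D → c D * shift (x +ℕ area D) f N)
      ≡⟨ sumOver-cong Ds (λ D → trans (cong (c D *_) (shift-as-Σ< (x +ℕ area D) f N)) (sym (Σ<-*ˡ (suc N) (c D) (λ v → 𝟙 (x +ℕ area D ≡ᵇ v) * f (N ∸ v))))) ⟩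
    sumOver Ds (λ D → Σ< (suc N) (λ v → c D * (𝟙 (x +ℕ area D ≡ᵇ v) * f (N ∸ v))))
      ≡⟨ sumOver-Σ< Ds (suc N) (λ D v → c D * (𝟙 (x +ℕ area D ≡ᵇ v) * f (N ∸ v))) ⟩
    Σ< (suc N) (λ v → sumOver Ds (λ D → c D * (𝟙 (x +ℕ area D ≡ᵇ v) * f (N ∸ v))))
      ≡⟨ Σ<-cong (suc N) (λ v _ → trans (sumOver-cong Ds (λ D → sym (ℤₚ.*-assoc (c D) _ (f (N ∸ v)))))
                                        (sumOver-*ʳ Ds (f (N ∸ v)) (λ D → c D * 𝟙 (x +ℕ area D ≡ᵇ v)))) ⟩
    Σ< (suc N) (λ v → sumOver Ds (λ D → c D * 𝟙 (x +ℕ area D ≡ᵇ v)) * f (N ∸ v))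
      ≡⟨ Σ<-cong (suc N) (λ v v≤N → cong (_* f (N ∸ v)) (head-count v (ℕₚ.m<1+n⇒m≤n v≤N))) ⟩
    Σ< (suc N) (λ v → fixedRowHead 1 x v * f (N ∸ v))
      ≡⟨ ·-coeff (fixedRowHead 1 x) f N ⟨
    (fixedRowHead 1 x · f) N
      ∎
    where
    open ≡-Reasoning
    f = pow ξ x

fixedRowHead-·-top : ∀ i N g → (fixedRowHead i (suc N) · g) N ≡ 0ℤ
fixedRowHead-·-top i N g =
  trans (at (shift-·ˡ (suc N) (belowHead i (suc N)) g) N) (shift-< (suc N) (belowHead i (suc N) · g) (ℕₚ.n<1+n N))

F̃at-expansion : ∀ ξ N → F̃at ξ N ≡ one N + Σ< (suc N) (λ y → (fixedRowHead 1 (suc y) · pow ξ (suc y)) N)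
F̃at-expansion ξ zero    = cong (1ℤ +_) (sym (trans (ℤₚ.+-identityˡ _) (fixedRowHead-·-top 1 0 (pow ξ 1))))
F̃at-expansion ξ (suc L) = cong (one N +_) (begin
  sumOver (allLists N N) (ferrersTerm ξ N)
    ≡⟨ sumOver-allLists-suc N L (ferrersTerm ξ N) ⟩
  0ℤ + Σ< (suc N) (λ x → sumOver (allLists N L) (λ D → ferrersTerm ξ N (x ∷ D)))
    ≡⟨ trans (ℤₚ.+-identityˡ _) (Σ<-head N (λ x → sumOver (allLists N L) (λ D → ferrersTerm ξ N (x ∷ D)))) ⟩
  sumOver (allLists N L) (λ _ → 0ℤ) + Σ< N (λ y → sumOver (allLists N L) (λ D → ferrersTerm ξ N (suc y ∷ D)))
    ≡⟨ cong₂ _+_ (sumOver-zero (allLists N L)) (Σ<-cong N (λ y y<N → ferrers-by-head ξ L y y<N)) ⟩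
  0ℤ + Σ< N A
    ≡⟨ ℤₚ.+-identityˡ _ ⟩
  Σ< N A
    ≡⟨ ℤₚ.+-identityʳ _ ⟨
  Σ< N A + 0ℤ
    ≡⟨ cong (Σ< N A +_) (fixedRowHead-·-top 1 N (pow ξ (suc N))) ⟨
  Σ< (suc N) A
    ∎)
  where
  open ≡-Reasoning
  N = suc L
  A : ℕ → ℤ
  A y = (fixedRowHead 1 (suc y) · pow ξ (suc y)) N

fixedRowHead-1-series : ∀ ξ N →
  Σ< (suc N) (λ y → (fixedRowHead 1 (suc y) · pow ξ (suc y)) N)
    ≡ ξ N - one N + Σ< (suc (suc N)) (λ m → (closedForm m · pow ξ m) N)
fixedRowHead-1-series ξ N = begin
  Σ< (suc N) A
    ≡⟨ Σ<-head N A ⟩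
  A 0 + Σ< N (A ∘ suc)
    ≡⟨ cong₂ _+_ first-head (Σ<-cong N (λ y _ → at (·-cong (fixedRowHead-1-2+ y) (≈-refl {pow ξ (suc (suc y))})) N)) ⟩
  ξ N + B 1 + Σ< N (B ∘ suc ∘ suc)
    ≡⟨ rearrange (ξ N) (one N) (B 1) (Σ< N (B ∘ suc ∘ suc)) ⟩
  ξ N - one N + (one N + (B 1 + Σ< N (B ∘ suc ∘ suc)))
    ≡⟨ cong (λ b → ξ N - one N + (b + (B 1 + Σ< N (B ∘ suc ∘ suc)))) B0 ⟨
  ξ N - one N + (B 0 + (B 1 + Σ< N (B ∘ suc ∘ suc)))
    ≡⟨ cong (λ s → ξ N - one N + s) (trans (Σ<-head (suc N) B) (cong (B 0 +_) (Σ<-head N (B ∘ suc)))) ⟨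
  ξ N - one N + Σ< (suc (suc N)) B
    ∎
  where
  open ≡-Reasoning
  A : ℕ → ℤ
  A y = (fixedRowHead 1 (suc y) · pow ξ (suc y)) N
  B : ℕ → ℤ
  B m = (closedForm m · pow ξ m) N
  closedForm-0-· : ∀ g → (closedForm 0 · g) N ≡ g N
  closedForm-0-· g = at (≈-trans (·-cong closedForm-0 (≈-refl {g})) (one-· g)) N
  B0 : B 0 ≡ one N
  B0 = closedForm-0-· one
  first-head : A 0 ≡ ξ N + B 1
  first-head = begin
    A 0                                                   ≡⟨ at (·-cong fixedRowHead-1-1 (≈-refl {pow ξ 1})) N ⟩
    (Σₛ 2 closedForm · pow ξ 1) N                         ≡⟨ at (Σₛ-· 2 closedForm (pow ξ 1)) N ⟩
    0ℤ + (closedForm 0 · pow ξ 1) N + B 1                 ≡⟨ cong (_+ B 1) (trans (ℤₚ.+-identityˡ _) (closedForm-0-· (pow ξ 1))) ⟩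
    pow ξ 1 N + B 1                                       ≡⟨ cong (_+ B 1) (at (·-one ξ) N) ⟩
    ξ N + B 1                                             ∎
  rearrange : ∀ a o b s → a + b + s ≡ a - o + (o + (b + s))
  rearrange = solve-∀

corollary7 : (ξ₀ : FPS) → (∀ N → Θ₀at (neg ξ₀) N ≡ 0ℤ) → ∀ N → ξ₀ N ≡ F̃at ξ₀ N
corollary7 ξ₀ Θ₀-root N = sym (begin
  F̃at ξ₀ N
    ≡⟨ F̃at-expansion ξ₀ N ⟩
  one N + Σ< (suc N) (λ y → (fixedRowHead 1 (suc y) · pow ξ₀ (suc y)) N)
    ≡⟨ cong (one N +_) (fixedRowHead-1-series ξ₀ N) ⟩
  one N + (ξ₀ N - one N + Σ< (suc (suc N)) (λ m → (closedForm m · pow ξ₀ m) N))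
    ≡⟨ cong (λ s → one N + (ξ₀ N - one N + s)) (closedForm-series-vanishes ξ₀ Θ₀-root N) ⟩
  one N + (ξ₀ N - one N + 0ℤ)
    ≡⟨ cancel (one N) (ξ₀ N) ⟩
  ξ₀ N
    ∎)
  where
  open ≡-Reasoning
  cancel : ∀ o x → o + (x - o + 0ℤ) ≡ x
  cancel = solve-∀
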